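{- Let $n\ge 2$, $l_1,\dots,l_n,l_\infty\ge 0$, let $x\in X(l_1,\dots,l_n,l_\infty)$, and let $i\ne j$ in $\{1,\dots,n\}$ satisfy $l_i=l_j$. Let $x'$ be the diagram obtained from $x$ by interchanging the labels $z_i$ and $z_j$ (keeping the points and arcs otherwise unchanged). Then there exists $g\in J_n$ with $gx=x'$.
   Context: An arc diagram of type $(l_1,\dots,l_n,l_\infty)$ consists of a circle (the boundary of a closed disc) carrying $n+1$ distinct marked points labelled $z_\infty,z_1,\dots,z_n$ (the labels $z_1,\dots,z_n$ may appear in any order), together with finitely many arcs inside the disc, pairwise non-intersecting except at endpoints, each joining two distinct marked points (several arcs may join the same pair), such that $z_k$ is an endpoint of exactly $l_k$ arcs. Diagrams are considered up to continuous deformation; $X(l_1,\dots,l_n,l_\infty)$ is the set of all of them. Going clockwise from $z_\infty$, the other marked points occupy positions $1,\dots,n$. The cactus group $J_n$ has generators $s_{p,q}$ ($1\le p<q\le n$) and relations $s_{p,q}^2=e$; $s_{p,q}s_{p',q'}=s_{p',q'}s_{p,q}$ if $[p,q]\cap[p',q']=\emptyset$; $s_{p,q}s_{p',q'}s_{p,q}=s_{p+q-q',p+q-p'}$ if $p\le p'<q'\le q$. It acts on $X(l_1,\dots,l_n,l_\infty)$ as follows: for $s_{p,q}$, take a chord $c$ separating the points in positions $p,\dots,q$ from the other marked points (arcs deformed to cross $c$ at most once), reflect the part of the diagram on the side of $c$ not containing $z_\infty$ across the perpendicular bisector of $c$ (reversing the order of the points in positions $p,\dots,q$ and of the crossing points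 on $c$), and rejoin the arc pieces across $c$. Products act right to left. -}

module Defs where

open import Data.Nat using (ℕ; zero; suc; _+_; _∸_; _≤_; _<_; s≤s; _⊔_; _⊓_; _≤ᵇ_; _<ᵇ_)
open import Data.Nat.Properties using (≤-trans; ∸-monoʳ-≤; m+n∸m≡n; ≤-reflexive; _≤?_)
open import Data.Fin as F using (Fin; toℕ; fromℕ<)
open import Data.Fin.Permutation.Components using (transpose)
open import Data.List using (List; []; _∷_; tabulate)
open import Data.Nat.ListAction using (sum)
open import Data.Bool using (Bool; true; false; if_then_else_; _∧_; not)
open import Data.Sum using (_⊎_)
open import Function.Definitions using (Injective)
open import Relation.Nullary using (yes; no)
open import Relation.Binary.PropositionalEquality using (_≡_)

-- The n+1 marked points are indexed by their POSITION t : Fin (suc n):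
-- position 0 is the point z∞, positions 1,…,n are the other points
-- in clockwise order from z∞.
-- Labels are also elements of Fin (suc n): label zero is z∞, label
-- (suc i) is z_{i+1} (so the label set {z₁,…,zₙ} is Fin n via suc).
--
--   lab t   = label of the point at position t
--   arc a b = number of arcs joining the points at positions a and b
--
-- Up to continuous deformation a diagram is determined by exactly this
-- data (arcs between the same two points are parallel; non-intersecting
-- arcs correspond to non-crossing pairs of positions).

record Diagram (n : ℕ) : Set where
  field
    lab : Fin (suc n) → Fin (suc n)
    arc : Fin (suc n) → Fin (suc n) → ℕ
open Diagram public

Σpos : ∀ {n} → (Fin (suc n) → ℕ) → ℕ
Σpos f = sum (tabulate f)

lvec : ∀ {n} → (Fin n → ℕ) → ℕ → Fin (suc n) → ℕ
lvec l l∞ F.zero    = l∞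
lvec l l∞ (F.suc i) = l i

record IsArcDiagram {n : ℕ} (l : Fin n → ℕ) (l∞ : ℕ) (x : Diagram n) : Set where
  field
    lab-∞     : lab x F.zero ≡ F.zero
    lab-inj   : Injective _≡_ _≡_ (lab x)
    arc-sym   : ∀ a b → arc x a b ≡ arc x b a
    arc-loop  : ∀ a → arc x a a ≡ 0
    arc-noncrossing : ∀ a b c d → a F.< b → b F.< c → c F.< d →
                      arc x a c ≡ 0 ⊎ arc x b d ≡ 0
    degree    : ∀ t → Σpos (arc x t) ≡ lvec l l∞ (lab x t)

record X {n : ℕ} (l : Fin n → ℕ) (l∞ : ℕ) : Set where
  constructor mkX
  field
    diagram : Diagram n
    valid   : IsArcDiagram l l∞ diagram
open X public

record _≈D_ {n : ℕ} (x y : Diagram n) : Set where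
  field
    lab-≈ : ∀ t → lab x t ≡ lab y t
    arc-≈ : ∀ a b → arc x a b ≡ arc y a b

record Gen (n : ℕ) : Set where
  constructor gen
  field
    p   : ℕ
    q   : ℕ
    1≤p : 1 ≤ p
    p<q : p < q
    q≤n : q ≤ n

private
  bound : ∀ p q t → p ≤ t → p + q ∸ t ≤ q
  bound p q t p≤t = ≤-trans (∸-monoʳ-≤ (p + q) p≤t) (≤-reflexive (m+n∸m≡n p q))

module Action {n : ℕ} (g : Gen n) (x : Diagram n) where
  open Gen g

  inner : Fin (suc n) → Bool
  inner t = (p ≤ᵇ toℕ t) ∧ (toℕ t ≤ᵇ q)

  refl : Fin (suc n) → Fin (suc n)
  refl t with p ≤? toℕ t | toℕ t ≤? q
  ... | yes a | yes _ = fromℕ< {p + q ∸ toℕ t} (s≤s (≤-trans (bound p q (toℕ t) a) q≤n))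
  ... | _     | _     = t

  [_]_ : Bool → ℕ → ℕ
  [ b ] k = if b then k else 0

  -- number of arcs from inner position t crossing the chord c
  cdIn : Fin (suc n) → ℕ
  cdIn t = Σpos (λ u → [ not (inner u) ] arc x t u)

  -- number of arcs from outer position u crossing the chord c
  cdOut : Fin (suc n) → ℕ
  cdOut u = Σpos (λ t → [ inner t ] arc x u t)

  cdIn' : Fin (suc n) → ℕ
  cdIn' a = cdIn (refl a)

  A : Fin (suc n) → ℕ
  A a = Σpos (λ s → [ inner s ∧ (toℕ s ≤ᵇ toℕ a) ] cdIn' s)

  -- order of the outer points along the chord, starting next to p:
  -- p−1, p−2, …, 0, n, n−1, …, q+1
  rank : Fin (suc n) → ℕ
  rank u = if toℕ u <ᵇ p then p ∸ toℕ u else p + suc (n ∸ toℕ u)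

  B : Fin (suc n) → ℕ
  B b = Σpos (λ u → [ not (inner u) ∧ (rank u ≤ᵇ rank b) ] cdOut u)

  -- rejoining: the k-th crossing point (along c) carries the k-th inner
  -- endpoint (reflected part) and the k-th outer endpoint; the number of
  -- rejoined arcs between inner a and outer b is the overlap of the
  -- corresponding index intervals.
  cross : Fin (suc n) → Fin (suc n) → ℕ
  cross a b = (A a ⊓ B b) ∸ ((A a ∸ cdIn' a) ⊔ (B b ∸ cdOut b))

  newArc : Fin (suc n) → Fin (suc n) → ℕ
  newArc a b with inner a | inner b
  ... | true  | true  = arc x (refl a) (refl b)
  ... | false | false = arc x a b
  ... | true  | false = cross a b
  ... | false | true  = cross b a

  result : Diagram n
  result = record { lab = λ t → lab x (refl t) ; arc = newArc }

act : ∀ {n} → Gen n → Diagram n → Diagram n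
act g x = Action.result g x

-- an element of J_n written as a word g₁ g₂ ⋯ g_k in the generators
-- (every element is such a product since s_{p,q}⁻¹ = s_{p,q});
-- products act right to left.
actWord : ∀ {n} → List (Gen n) → Diagram n → Diagram n
actWord []      x = x
actWord (g ∷ w) x = act g (actWord w x)

swapLabels : ∀ {n} → Fin n → Fin n → Diagram n → Diagram n
swapLabels i j x = record
  { lab = λ t → transpose (F.suc i) (F.suc j) (lab x t)
  ; arc = arc x }

-- Let z_i and z_j sit at positions α < β. If β = α + 1, the generator s_{α,β} exchanges the two
-- points, and because they have the same degree rejoining the arcs across the chord gives back
-- exactly the old arcs, so only the labels move. Otherwise take s_{α+1,β} s_{α,α+1} s_{α+1,β}:
-- the first reflection brings z_j next to z_i, the adjacent case swaps them, and the last
-- reflection undoes the first on arcs, since each s_{p,q} is an involution there.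
-- Both facts rest on one observation: the arcs crossing a chord form a matrix (inner points ×
-- outer points, ordered along the chord) whose support is a monotone staircase, and such a matrix
-- is determined by its row and column sums (the northwest-corner rule), which is precisely how
-- the action rejoins the arcs.

module Submission where

open import Defs
open import Data.Nat
open import Data.Nat.Properties
open import Data.Nat.Solver using (module +-*-Solver)
open import Data.Bool using (Bool; true; false; if_then_else_; _∧_; not; T)
open import Data.Unit using (tt)
open import Data.Empty using (⊥; ⊥-elim)
open import Data.Product using (∃; _×_; _,_; proj₁; proj₂)
open import Data.Sum using (_⊎_; inj₁; inj₂)
open import Data.Fin as F using (Fin; toℕ; fromℕ<; punchOut)
open import Data.Fin.Properties
  using (toℕ-fromℕ<; toℕ-injective; toℕ≤pred[n]; any?; punchOut-injective; injective⇒≤)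
  renaming (suc-injective to Fin-suc-injective)
open import Data.Fin.Permutation.Components using (transpose)
open import Data.List using (List; []; _∷_; tabulate)
open import Data.Nat.ListAction using (sum)
open import Function.Base using (_∘_)
open import Function.Definitions using (Injective)
open import Relation.Binary using (tri<; tri≈; tri>)
open import Relation.Binary.PropositionalEquality
open import Relation.Nullary using (yes; no; Dec; contradiction)
open +-*-Solver using (solve; _:+_; con; _:=_)

cong₄ : ∀ {A : Set} (f : A → A → A → A → A) {a a' b b' c c' d d'} →
        a ≡ a' → b ≡ b' → c ≡ c' → d ≡ d' → f a b c d ≡ f a' b' c' d'
cong₄ f refl refl refl refl = refl

-- Finite sums

Σ< : ℕ → (ℕ → ℕ) → ℕ
Σ< zero    f = 0
Σ< (suc m) f = f 0 + Σ< m (λ k → f (suc k))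

Σ<-cong : ∀ m {f g : ℕ → ℕ} → (∀ k → k < m → f k ≡ g k) → Σ< m f ≡ Σ< m g
Σ<-cong zero    f≗g = refl
Σ<-cong (suc m) f≗g = cong₂ _+_ (f≗g 0 z<s) (Σ<-cong m (λ k k<m → f≗g (suc k) (s<s k<m)))

Σ<-zero : ∀ m {f : ℕ → ℕ} → (∀ k → k < m → f k ≡ 0) → Σ< m f ≡ 0
Σ<-zero zero    f≗0 = refl
Σ<-zero (suc m) f≗0 rewrite f≗0 0 z<s = Σ<-zero m (λ k k<m → f≗0 (suc k) (s<s k<m))

Σ<-+ : ∀ m (f g : ℕ → ℕ) → Σ< m (λ k → f k + g k) ≡ Σ< m f + Σ< m g
Σ<-+ zero    f g = refl
Σ<-+ (suc m) f g rewrite Σ<-+ m (λ k → f (suc k)) (λ k → g (suc k)) =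
  +-+-comm (f 0) (g 0) _ _
  where
  +-+-comm : ∀ a b c d → (a + b) + (c + d) ≡ (a + c) + (b + d)
  +-+-comm = solve 4 (λ a b c d → (a :+ b) :+ (c :+ d) := (a :+ c) :+ (b :+ d)) refl

Σ<-split : ∀ m d (f : ℕ → ℕ) → Σ< (m + d) f ≡ Σ< m f + Σ< d (λ k → f (m + k))
Σ<-split zero    d f = refl
Σ<-split (suc m) d f rewrite Σ<-split m d (λ k → f (suc k)) = sym (+-assoc (f 0) _ _)

Σ<-suc : ∀ m (f : ℕ → ℕ) → Σ< (suc m) f ≡ Σ< m f + f m
Σ<-suc m f = begin
  Σ< (suc m) f                       ≡⟨ cong (λ k → Σ< k f) (+-comm 1 m) ⟩
  Σ< (m + 1) f                       ≡⟨ Σ<-split m 1 f ⟩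
  Σ< m f + (f (m + 0) + 0)           ≡⟨ cong (λ k → Σ< m f + k) (trans (+-identityʳ _) (cong f (+-identityʳ m))) ⟩
  Σ< m f + f m                       ∎
  where open ≡-Reasoning

Σ<-suc-∸ : ∀ m (f : ℕ → ℕ) → Σ< (suc m) f ∸ f m ≡ Σ< m f
Σ<-suc-∸ m f = trans (cong (_∸ f m) (Σ<-suc m f)) (m+n∸n≡m (Σ< m f) (f m))

Σ<-reverse : ∀ m (f : ℕ → ℕ) → Σ< m f ≡ Σ< m (λ k → f (m ∸ suc k))
Σ<-reverse zero    f = refl
Σ<-reverse (suc m) f = begin
  f 0 + Σ< m (λ k → f (suc k))                  ≡⟨ cong (f 0 +_) (Σ<-reverse m (λ k → f (suc k))) ⟩
  f 0 + Σ< m (λ k → f (suc (m ∸ suc k)))        ≡⟨ +-comm (f 0) _ ⟩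
  Σ< m (λ k → f (suc (m ∸ suc k))) + f 0        ≡⟨ cong₂ _+_ (Σ<-cong m (λ k k<m → cong f (sym (+-∸-assoc 1 k<m))))
                                                               (cong f (sym (n∸n≡0 m))) ⟩
  Σ< m (λ k → f (suc m ∸ suc k)) + f (m ∸ m)    ≡⟨ sym (Σ<-suc m (λ k → f (suc m ∸ suc k))) ⟩
  Σ< (suc m) (λ k → f (suc m ∸ suc k))          ∎
  where open ≡-Reasoning

Σ<-comm : ∀ m d (f : ℕ → ℕ → ℕ) → Σ< m (λ i → Σ< d (f i)) ≡ Σ< d (λ j → Σ< m (λ i → f i j))
Σ<-comm zero    d f = sym (Σ<-zero d (λ _ _ → refl))
Σ<-comm (suc m) d f = begin
  Σ< d (f 0) + Σ< m (λ i → Σ< d (f (suc i)))                 ≡⟨ cong (Σ< d (f 0) +_) (Σ<-comm m d (λ i → f (suc i))) ⟩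
  Σ< d (f 0) + Σ< d (λ j → Σ< m (λ i → f (suc i) j))         ≡⟨ sym (Σ<-+ d (f 0) (λ j → Σ< m (λ i → f (suc i) j))) ⟩
  Σ< d (λ j → Σ< (suc m) (λ i → f i j))                      ∎
  where open ≡-Reasoning

Σ<-monoˡ-≤ : ∀ {m m'} (f : ℕ → ℕ) → m ≤ m' → Σ< m f ≤ Σ< m' f
Σ<-monoˡ-≤ {m} f m≤m' = subst (λ k → Σ< m f ≤ Σ< k f) (m+[n∸m]≡n m≤m')
  (≤-trans (m≤m+n _ _) (≤-reflexive (sym (Σ<-split m _ f))))

Σ<-pos⇒term-pos : ∀ m (f : ℕ → ℕ) → 0 < Σ< m f → ∃ λ k → k < m × 0 < f k
Σ<-pos⇒term-pos (suc m) f pos with f 0 in eq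
... | suc _ = 0 , z<s , subst (0 <_) (sym eq) z<s
... | zero with Σ<-pos⇒term-pos m (λ k → f (suc k)) pos
...   | k , k<m , fk>0 = suc k , s<s k<m , fk>0

sum-tabulate : ∀ m (f : Fin m → ℕ) (g : ℕ → ℕ) → (∀ t → f t ≡ g (toℕ t)) → sum (tabulate f) ≡ Σ< m g
sum-tabulate zero    f g f≗g = refl
sum-tabulate (suc m) f g f≗g =
  cong₂ _+_ (f≗g F.zero) (sum-tabulate m (λ t → f (F.suc t)) (λ k → g (suc k)) (λ t → f≗g (F.suc t)))

≤ᵇ-true : ∀ {m n} → m ≤ n → (m ≤ᵇ n) ≡ true
≤ᵇ-true {m} {n} m≤n with m ≤ᵇ n in eq
... | true  = refl
... | false = ⊥-elim (subst T eq (≤⇒≤ᵇ m≤n))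

≤ᵇ-false : ∀ {m n} → n < m → (m ≤ᵇ n) ≡ false
≤ᵇ-false {m} {n} n<m with m ≤ᵇ n in eq
... | false = refl
... | true  = ⊥-elim (<⇒≱ n<m (≤ᵇ⇒≤ m n (subst T (sym eq) tt)))

<ᵇ-true : ∀ {m n} → m < n → (m <ᵇ n) ≡ true
<ᵇ-true {m} {n} m<n with m <ᵇ n in eq
... | true  = refl
... | false = ⊥-elim (subst T eq (<⇒<ᵇ m<n))

<ᵇ-false : ∀ {m n} → n ≤ m → (m <ᵇ n) ≡ false
<ᵇ-false {m} {n} n≤m with m <ᵇ n in eq
... | false = refl
... | true  = ⊥-elim (<⇒≱ (<ᵇ⇒< m n (subst T (sym eq) tt)) n≤m)

≤ᵇ-true⁻¹ : ∀ {m n} → (m ≤ᵇ n) ≡ true → m ≤ n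
≤ᵇ-true⁻¹ {m} {n} eq = ≤ᵇ⇒≤ m n (subst T (sym eq) tt)

≤ᵇ-false⁻¹ : ∀ {m n} → (m ≤ᵇ n) ≡ false → n < m
≤ᵇ-false⁻¹ eq = ≰⇒> (λ m≤n → subst T eq (≤⇒≤ᵇ m≤n))

+-≤ᵇ-+ : ∀ a b c → (a + b ≤ᵇ a + c) ≡ (b ≤ᵇ c)
+-≤ᵇ-+ a b c with b ≤? c
... | yes b≤c = trans (≤ᵇ-true (+-monoʳ-≤ a b≤c)) (sym (≤ᵇ-true b≤c))
... | no  b≰c = trans (≤ᵇ-false (+-monoʳ-< a (≰⇒> b≰c))) (sym (≤ᵇ-false (≰⇒> b≰c)))

when : Bool → ℕ → ℕ
when b k = if b then k else 0

when-∧ : ∀ a b k → when (a ∧ b) k ≡ when a (when b k)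
when-∧ true  b k = refl
when-∧ false b k = refl

when-pos : ∀ b k → 0 < when b k → b ≡ true × 0 < k
when-pos true k pos = refl , pos

Σ<-when-≤ᵇ : ∀ m t (f : ℕ → ℕ) → t < m → Σ< m (λ k → when (k ≤ᵇ t) (f k)) ≡ Σ< (suc t) f
Σ<-when-≤ᵇ m t f t<m = begin
  Σ< m g                                      ≡⟨ cong (λ k → Σ< k g) (sym (m+[n∸m]≡n t<m)) ⟩
  Σ< (suc t + (m ∸ suc t)) g                  ≡⟨ Σ<-split (suc t) (m ∸ suc t) g ⟩
  Σ< (suc t) g + Σ< (m ∸ suc t) (λ k → g (suc t + k))
    ≡⟨ cong₂ _+_ (Σ<-cong (suc t) (λ k k≤t → cong (λ b → when b (f k)) (≤ᵇ-true (s≤s⁻¹ k≤t))))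
                 (Σ<-zero (m ∸ suc t) (λ k _ → cong (λ b → when b (f (suc t + k))) (≤ᵇ-false (s≤s (m≤m+n t k))))) ⟩
  Σ< (suc t) f + 0                            ≡⟨ +-identityʳ _ ⟩
  Σ< (suc t) f                                ∎
  where
  open ≡-Reasoning
  g : ℕ → ℕ
  g k = when (k ≤ᵇ t) (f k)

-- Overlaps of intervals and the northwest-corner rule

overlapLen : ℕ → ℕ → ℕ → ℕ → ℕ
overlapLen lo hi lo' hi' = (hi ⊓ hi') ∸ (lo ⊔ lo')

overlapLen-pos : ∀ lo hi lo' hi' → 0 < overlapLen lo hi lo' hi' → (lo < hi × lo < hi') × (lo' < hi × lo' < hi')
overlapLen-pos lo hi lo' hi' pos =
    (≤-<-trans (m≤m⊔n lo lo') (<-≤-trans lt (m⊓n≤m hi hi')) , ≤-<-trans (m≤m⊔n lo lo') (<-≤-trans lt (m⊓n≤n hi hi')))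
  , (≤-<-trans (m≤n⊔m lo lo') (<-≤-trans lt (m⊓n≤m hi hi')) , ≤-<-trans (m≤n⊔m lo lo') (<-≤-trans lt (m⊓n≤n hi hi')))
  where
  lt : lo ⊔ lo' < hi ⊓ hi'
  lt = ≰⇒> (λ le → <⇒≢ pos (sym (m≤n⇒m∸n≡0 le)))

overlapLen-disjoint : ∀ lo hi lo' hi' → (hi ≤ lo ⊎ hi' ≤ lo' ⊎ hi ≤ lo' ⊎ hi' ≤ lo) → overlapLen lo hi lo' hi' ≡ 0
overlapLen-disjoint lo hi lo' hi' disj = m≤n⇒m∸n≡0 (go disj)
  where
  go : (hi ≤ lo ⊎ hi' ≤ lo' ⊎ hi ≤ lo' ⊎ hi' ≤ lo) → hi ⊓ hi' ≤ lo ⊔ lo'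
  go (inj₁ le)               = ≤-trans (m⊓n≤m hi hi') (≤-trans le (m≤m⊔n lo lo'))
  go (inj₂ (inj₁ le))        = ≤-trans (m⊓n≤n hi hi') (≤-trans le (m≤n⊔m lo lo'))
  go (inj₂ (inj₂ (inj₁ le))) = ≤-trans (m⊓n≤m hi hi') (≤-trans le (m≤n⊔m lo lo'))
  go (inj₂ (inj₂ (inj₂ le))) = ≤-trans (m⊓n≤n hi hi') (≤-trans le (m≤m⊔n lo lo'))

∸-telescope : ∀ u P X → u ≤ P → P ≤ X → (P ∸ u) + (X ∸ P) ≡ X ∸ u
∸-telescope u P X u≤P P≤X with m≤n⇒∃[o]m+o≡n u≤P | m≤n⇒∃[o]m+o≡n P≤X
... | a , refl | b , refl = trans (cong₂ _+_ (m+n∸m≡n u a) (m+n∸m≡n (u + a) b))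
  (sym (trans (cong (_∸ u) (+-assoc u a b)) (m+n∸m≡n u (a + b))))

overlapLen-step : ∀ u v P Q → u ≤ v → P ≤ Q → ((v ⊓ P) ∸ u) + overlapLen P Q u v ≡ (v ⊓ Q) ∸ u
overlapLen-step u v P Q u≤v P≤Q with ≤-total P u
... | inj₁ P≤u = cong₂ _+_ (m≤n⇒m∸n≡0 (≤-trans (m⊓n≤n v P) P≤u)) (cong₂ _∸_ (⊓-comm Q v) (m≤n⇒m⊔n≡n P≤u))
... | inj₂ u≤P with ≤-total v P
...   | inj₁ v≤P = trans (cong₂ _+_ (cong (_∸ u) (m≤n⇒m⊓n≡m v≤P))
                                    (trans (cong₂ _∸_ (m≥n⇒m⊓n≡n (≤-trans v≤P P≤Q)) (m≥n⇒m⊔n≡m u≤P)) (m≤n⇒m∸n≡0 v≤P)))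
                         (trans (+-identityʳ _) (cong (_∸ u) (sym (m≤n⇒m⊓n≡m (≤-trans v≤P P≤Q)))))
...   | inj₂ P≤v = trans (cong₂ _+_ (cong (_∸ u) (m≥n⇒m⊓n≡n P≤v)) (cong ((Q ⊓ v) ∸_) (m≥n⇒m⊔n≡m u≤P)))
                         (trans (∸-telescope u P (Q ⊓ v) u≤P (⊓-glb P≤Q P≤v)) (cong (_∸ u) (⊓-comm Q v)))

-- The intervals [Σ< k w, Σ< (suc k) w) tile [0, Σ< m w), so their overlaps with [u, v) add up.
Σ<-overlapLen : ∀ (w : ℕ → ℕ) m u v → u ≤ v →
             Σ< m (λ k → overlapLen (Σ< k w) (Σ< (suc k) w) u v) ≡ (v ⊓ Σ< m w) ∸ u
Σ<-overlapLen w zero    u v u≤v = sym (trans (cong (_∸ u) (⊓-zeroʳ v)) (0∸n≡0 u))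
Σ<-overlapLen w (suc m) u v u≤v = begin
  Σ< (suc m) (λ k → overlapLen (Σ< k w) (Σ< (suc k) w) u v)
    ≡⟨ Σ<-suc m _ ⟩
  Σ< m (λ k → overlapLen (Σ< k w) (Σ< (suc k) w) u v) + overlapLen (Σ< m w) (Σ< (suc m) w) u v
    ≡⟨ cong (_+ overlapLen (Σ< m w) (Σ< (suc m) w) u v) (Σ<-overlapLen w m u v u≤v) ⟩
  ((v ⊓ Σ< m w) ∸ u) + overlapLen (Σ< m w) (Σ< (suc m) w) u v
    ≡⟨ overlapLen-step u v (Σ< m w) (Σ< (suc m) w) u≤v (Σ<-monoˡ-≤ w (n≤1+n m)) ⟩
  (v ⊓ Σ< (suc m) w) ∸ u
    ∎
  where open ≡-Reasoning

overlapLen-comm : ∀ lo hi lo' hi' → overlapLen lo hi lo' hi' ≡ overlapLen lo' hi' lo hi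
overlapLen-comm lo hi lo' hi' = cong₂ _∸_ (⊓-comm hi hi') (⊔-comm lo lo')

Σ<-overlapLen-cell : ∀ (w v : ℕ → ℕ) m j → Σ< (suc j) v ≤ Σ< m w →
  Σ< m (λ k → overlapLen (Σ< k w) (Σ< (suc k) w) (Σ< j v) (Σ< (suc j) v)) ≡ v j
Σ<-overlapLen-cell w v m j inside = begin
  Σ< m (λ k → overlapLen (Σ< k w) (Σ< (suc k) w) (Σ< j v) (Σ< (suc j) v))
    ≡⟨ Σ<-overlapLen w m (Σ< j v) (Σ< (suc j) v) (Σ<-monoˡ-≤ v (n≤1+n j)) ⟩
  (Σ< (suc j) v ⊓ Σ< m w) ∸ Σ< j v
    ≡⟨ cong (_∸ Σ< j v) (trans (m≤n⇒m⊓n≡m inside) (Σ<-suc j v)) ⟩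
  (Σ< j v + v j) ∸ Σ< j v
    ≡⟨ m+n∸m≡n (Σ< j v) (v j) ⟩
  v j
    ∎
  where open ≡-Reasoning

∸<⇒pos : ∀ {x y} → x ∸ y < x → 0 < y
∸<⇒pos {x} {zero}  lt = ⊥-elim (<-irrefl refl lt)
∸<⇒pos {x} {suc y} _  = z<s

zero⊎zero : ∀ x y → (0 < x → 0 < y → ⊥) → x ≡ 0 ⊎ y ≡ 0
zero⊎zero zero    y       _   = inj₁ refl
zero⊎zero (suc x) zero    _   = inj₂ refl
zero⊎zero (suc x) (suc y) ¬xy = ⊥-elim (¬xy z<s z<s)

≮0⇒≡0 : ∀ x → (0 < x → ⊥) → x ≡ 0
≮0⇒≡0 zero    _  = refl
≮0⇒≡0 (suc x) ¬x = ⊥-elim (¬x z<s)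

-- In the staircase lemma below, the centre entry m has row interval [nw+n+ne, nw+n+ne+w+m+e)
-- and column interval [nw+w+sw, nw+w+sw+n+m+s), where the letters are block sums.
overlapLen-centre-pos : ∀ nw n w m e s → (n ≡ 0 ⊎ w ≡ 0) → (e ≡ 0 ⊎ s ≡ 0) →
  m ≡ overlapLen (nw + n + 0) ((nw + n + 0) + (w + m + e)) (nw + w + 0) ((nw + w + 0) + (n + m + s))
overlapLen-centre-pos nw n w m e s nw0 es0 = sym (begin
    (((nw + n + 0) + (w + m + e)) ⊓ ((nw + w + 0) + (n + m + s))) ∸ ((nw + n + 0) ⊔ (nw + w + 0))
  ≡⟨ cong₂ (λ a b → (a ⊓ b) ∸ ((nw + n + 0) ⊔ (nw + w + 0)))
       (solve 6 (λ nw n w m e s → (nw :+ n :+ con 0) :+ (w :+ m :+ e) := (nw :+ (n :+ w) :+ m) :+ e) refl nw n w m e s)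
       (solve 6 (λ nw n w m e s → (nw :+ w :+ con 0) :+ (n :+ m :+ s) := (nw :+ (n :+ w) :+ m) :+ s) refl nw n w m e s) ⟩
    (((nw + (n + w) + m) + e) ⊓ ((nw + (n + w) + m) + s)) ∸ ((nw + n + 0) ⊔ (nw + w + 0))
  ≡⟨ cong₂ _∸_ (+-⊓-of-zero (nw + (n + w) + m) e s es0) (cong₂ _⊔_ (+-identityʳ (nw + n)) (+-identityʳ (nw + w))) ⟩
    (nw + (n + w) + m) ∸ ((nw + n) ⊔ (nw + w))
  ≡⟨ cong ((nw + (n + w) + m) ∸_) (trans (sym (+-distribˡ-⊔ nw n w)) (cong (nw +_) (⊔-of-zero n w nw0))) ⟩
    (nw + (n + w) + m) ∸ (nw + (n + w))
  ≡⟨ m+n∸m≡n (nw + (n + w)) m ⟩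
    m ∎)
  where
  open ≡-Reasoning
  ⊔-of-zero : ∀ n w → (n ≡ 0 ⊎ w ≡ 0) → n ⊔ w ≡ n + w
  ⊔-of-zero n w (inj₁ refl) = refl
  ⊔-of-zero n w (inj₂ refl) = trans (⊔-identityʳ n) (sym (+-identityʳ n))
  +-⊓-of-zero : ∀ T e s → (e ≡ 0 ⊎ s ≡ 0) → (T + e) ⊓ (T + s) ≡ T
  +-⊓-of-zero T e s es0 = trans (sym (+-distribˡ-⊓ T e s)) (trans (cong (T +_) (⊓-of-zero es0)) (+-identityʳ T))
    where
    ⊓-of-zero : (e ≡ 0 ⊎ s ≡ 0) → e ⊓ s ≡ 0
    ⊓-of-zero (inj₁ refl) = refl
    ⊓-of-zero (inj₂ refl) = ⊓-zeroʳ e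

overlapLen-centre-zero : ∀ nw n ne w e sw s →
  (0 < n → 0 < w → ⊥) → (0 < e → 0 < s → ⊥) → (0 < w → 0 < ne → ⊥) → (0 < n → 0 < sw → ⊥) →
  0 ≡ overlapLen (nw + n + ne) ((nw + n + ne) + (w + 0 + e)) (nw + w + sw) ((nw + w + sw) + (n + 0 + s))
overlapLen-centre-zero nw n ne w e sw s ¬nw ¬es ¬wne ¬nsw =
  sym (overlapLen-disjoint _ _ _ _ (disjoint n ne w e sw s ¬nw ¬es ¬wne ¬nsw))
  where
  disjoint : ∀ n ne w e sw s → (0 < n → 0 < w → ⊥) → (0 < e → 0 < s → ⊥) → (0 < w → 0 < ne → ⊥) → (0 < n → 0 < sw → ⊥) →
      ((nw + n + ne) + (w + 0 + e)) ≤ (nw + n + ne) ⊎ ((nw + w + sw) + (n + 0 + s)) ≤ (nw + w + sw)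
    ⊎ ((nw + n + ne) + (w + 0 + e)) ≤ (nw + w + sw) ⊎ ((nw + w + sw) + (n + 0 + s)) ≤ (nw + n + ne)
  disjoint n       ne       zero    zero    sw       s       _ _ _ _ = inj₁ (≤-reflexive (+-identityʳ _))
  disjoint zero    ne       w       e       sw       zero    _ _ _ _ = inj₂ (inj₁ (≤-reflexive (+-identityʳ _)))
  disjoint (suc n) ne       (suc w) e       sw       s       ¬nw _ _ _ = ⊥-elim (¬nw z<s z<s)
  disjoint zero    (suc ne) (suc w) e       sw       s       _ _ ¬wne _ = ⊥-elim (¬wne z<s z<s)
  disjoint zero    zero     (suc w) (suc e) sw       (suc s) _ ¬es _ _ = ⊥-elim (¬es z<s z<s)
  disjoint zero    zero     (suc w) zero    sw       (suc s) _ _ _ _ = inj₂ (inj₂ (inj₁ (≤-trans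
    (≤-reflexive (solve 2 (λ nw w → (nw :+ con 0 :+ con 0) :+ (con 1 :+ w :+ con 0 :+ con 0) := nw :+ (con 1 :+ w) :+ con 0) refl nw w))
    (+-monoʳ-≤ (nw + suc w) z≤n))))
  disjoint n       ne       zero    (suc e) sw       (suc s) _ ¬es _ _ = ⊥-elim (¬es z<s z<s)
  disjoint (suc n) ne       zero    (suc e) (suc sw) zero    _ _ _ ¬nsw = ⊥-elim (¬nsw z<s z<s)
  disjoint (suc n) ne       zero    (suc e) zero     zero    _ _ _ _ = inj₂ (inj₂ (inj₂ (≤-trans
    (≤-reflexive (solve 2 (λ nw n → (nw :+ con 0 :+ con 0) :+ (con 1 :+ n :+ con 0 :+ con 0) := nw :+ (con 1 :+ n) :+ con 0) refl nw n))
    (+-monoʳ-≤ (nw + suc n) z≤n))))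

MonotoneSupport : (ℕ → ℕ → ℕ) → ℕ → ℕ → Set
MonotoneSupport Mat L K =
  ∀ a a' b b' → a < a' → a' < L → b < K → b' < K → 0 < Mat a b → 0 < Mat a' b' → b ≤ b'

-- The (i, j) entry splits the L × K matrix into nine blocks; monotone support
-- forces enough of them to vanish that the entry equals the overlap of its row and
-- column intervals.
module Staircase (Mat : ℕ → ℕ → ℕ) (i L' j K' : ℕ) (mono : MonotoneSupport Mat (i + suc L') (j + suc K')) where

  L K : ℕ
  L = i + suc L'
  K = j + suc K'

  row col : ℕ → ℕ
  row a = Σ< K (Mat a)
  col b = Σ< L (λ a → Mat a b)

  NW N NE W M E SW S : ℕ
  NW = Σ< i (λ a → Σ< j (Mat a))
  N  = Σ< i (λ a → Mat a j)
  NE = Σ< i (λ a → Σ< K' (λ b → Mat a (j + suc b)))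
  W  = Σ< j (Mat i)
  M  = Mat i j
  E  = Σ< K' (λ b → Mat i (j + suc b))
  SW = Σ< L' (λ a → Σ< j (Mat (i + suc a)))
  S  = Σ< L' (λ a → Mat (i + suc a) j)

  row-split : ∀ a → row a ≡ Σ< j (Mat a) + Mat a j + Σ< K' (λ b → Mat a (j + suc b))
  row-split a = trans (Σ<-split j (suc K') (Mat a))
    (trans (cong (λ z → Σ< j (Mat a) + (Mat a z + Σ< K' (λ b → Mat a (j + suc b)))) (+-identityʳ j))
      (sym (+-assoc (Σ< j (Mat a)) _ _)))

  col-split : ∀ b → col b ≡ Σ< i (λ a → Mat a b) + Mat i b + Σ< L' (λ a → Mat (i + suc a) b)
  col-split b = trans (Σ<-split i (suc L') (λ a → Mat a b))
    (trans (cong (λ z → Σ< i (λ a → Mat a b) + (Mat z b + Σ< L' (λ a → Mat (i + suc a) b))) (+-identityʳ i))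
      (sym (+-assoc (Σ< i (λ a → Mat a b)) _ _)))

  rows-above : Σ< i row ≡ NW + N + NE
  rows-above = trans (Σ<-cong i (λ a _ → row-split a))
    (trans (Σ<-+ i (λ a → Σ< j (Mat a) + Mat a j) (λ a → Σ< K' (λ b → Mat a (j + suc b))))
      (cong (_+ NE) (Σ<-+ i (λ a → Σ< j (Mat a)) (λ a → Mat a j))))

  rows-through : Σ< (suc i) row ≡ (NW + N + NE) + (W + M + E)
  rows-through = trans (Σ<-suc i row) (cong₂ _+_ rows-above (row-split i))

  cols-left : Σ< j col ≡ NW + W + SW
  cols-left = trans (Σ<-cong j (λ b _ → col-split b))
    (trans (Σ<-+ j (λ b → Σ< i (λ a → Mat a b) + Mat i b) (λ b → Σ< L' (λ a → Mat (i + suc a) b)))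
      (cong₂ _+_ (trans (Σ<-+ j (λ b → Σ< i (λ a → Mat a b)) (Mat i))
                        (cong (_+ W) (sym (Σ<-comm i j Mat))))
                 (Σ<-comm j L' (λ b a → Mat (i + suc a) b))))

  cols-through : Σ< (suc j) col ≡ (NW + W + SW) + (N + M + S)
  cols-through = trans (Σ<-suc j col) (cong₂ _+_ cols-left (col-split j))

  private
    i<L : i < L
    i<L = m<m+n i z<s
    j<K : j < K
    j<K = m<m+n j z<s
    below : ∀ a → a < L' → i + suc a < L
    below a a<L' = +-monoʳ-< i (s<s a<L')
    right : ∀ b → b < K' → j + suc b < K
    right b b<K' = +-monoʳ-< j (s<s b<K')
    left : ∀ b → b < j → b < K
    left b b<j = <-trans b<j j<K
    ¬right≤ : ∀ b → j + suc b ≤ j → ⊥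
    ¬right≤ b = m+1+n≰m j
    pos-term₂ : ∀ m d (f : ℕ → ℕ → ℕ) → 0 < Σ< m (λ a → Σ< d (f a)) → ∃ λ a → ∃ λ b → a < m × b < d × 0 < f a b
    pos-term₂ m d f pos with Σ<-pos⇒term-pos m _ pos
    ... | a , a<m , pos' with Σ<-pos⇒term-pos d (f a) pos'
    ...   | b , b<d , pos'' = a , b , a<m , b<d , pos''

  ¬N∧W : 0 < N → 0 < W → ⊥
  ¬N∧W pN pW with Σ<-pos⇒term-pos i _ pN | Σ<-pos⇒term-pos j _ pW
  ... | a , a<i , p | b , b<j , q = <⇒≱ b<j (mono a i j b a<i i<L j<K (left b b<j) p q)

  ¬E∧S : 0 < E → 0 < S → ⊥
  ¬E∧S pE pS with Σ<-pos⇒term-pos K' _ pE | Σ<-pos⇒term-pos L' _ pS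
  ... | b , b<K' , p | a , a<L' , q = ¬right≤ b (mono i (i + suc a) (j + suc b) j (m<m+n i z<s) (below a a<L') (right b b<K') j<K p q)

  ¬W∧NE : 0 < W → 0 < NE → ⊥
  ¬W∧NE pW pNE with Σ<-pos⇒term-pos j _ pW | pos-term₂ i K' (λ a b → Mat a (j + suc b)) pNE
  ... | b , b<j , p | a , b' , a<i , b'<K' , q =
    ¬right≤ b' (≤-trans (mono a i (j + suc b') b a<i i<L (right b' b'<K') (left b b<j) q p) (<⇒≤ b<j))

  ¬N∧SW : 0 < N → 0 < SW → ⊥
  ¬N∧SW pN pSW with Σ<-pos⇒term-pos i _ pN | pos-term₂ L' j (λ a b → Mat (i + suc a) b) pSW
  ... | a , a<i , p | a' , b , a'<L' , b<j , q =
    <⇒≱ b<j (mono a (i + suc a') j b (<-trans a<i (m<m+n i z<s)) (below a' a'<L') j<K (left b b<j) p q)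

  M⇒NE≡0 : 0 < M → NE ≡ 0
  M⇒NE≡0 pM = ≮0⇒≡0 NE λ pNE → case pNE
    where
    case : 0 < NE → ⊥
    case pNE with pos-term₂ i K' (λ a b → Mat a (j + suc b)) pNE
    ... | a , b' , a<i , b'<K' , q = ¬right≤ b' (mono a i (j + suc b') j a<i i<L (right b' b'<K') j<K q pM)

  M⇒SW≡0 : 0 < M → SW ≡ 0
  M⇒SW≡0 pM = ≮0⇒≡0 SW λ pSW → case pSW
    where
    case : 0 < SW → ⊥
    case pSW with pos-term₂ L' j (λ a b → Mat (i + suc a) b) pSW
    ... | a' , b , a'<L' , b<j , q = <⇒≱ b<j (mono i (i + suc a') j b (m<m+n i z<s) (below a' a'<L') j<K (left b b<j) pM q)

  centre : ∀ m → m ≡ M →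
    m ≡ overlapLen (NW + N + NE) ((NW + N + NE) + (W + m + E)) (NW + W + SW) ((NW + W + SW) + (N + m + S))
  centre zero    _ = overlapLen-centre-zero NW N NE W E SW S ¬N∧W ¬E∧S ¬W∧NE ¬N∧SW
  centre (suc m) eq rewrite M⇒NE≡0 (subst (0 <_) eq z<s) | M⇒SW≡0 (subst (0 <_) eq z<s) =
    overlapLen-centre-pos NW N W (suc m) E S (zero⊎zero N W ¬N∧W) (zero⊎zero E S ¬E∧S)

  entry : Mat i j ≡ overlapLen (Σ< i row) (Σ< (suc i) row) (Σ< j col) (Σ< (suc j) col)
  entry rewrite rows-through | cols-through | rows-above | cols-left = centre M refl

EntryIsOverlap : (ℕ → ℕ → ℕ) → ℕ → ℕ → ℕ → ℕ → Set
EntryIsOverlap Mat L K i j =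
  Mat i j ≡ overlapLen (Σ< i (λ a → Σ< K (Mat a))) (Σ< (suc i) (λ a → Σ< K (Mat a)))
                       (Σ< j (λ b → Σ< L (λ a → Mat a b))) (Σ< (suc j) (λ b → Σ< L (λ a → Mat a b)))

staircase : ∀ (Mat : ℕ → ℕ → ℕ) L K i j → i < L → j < K → MonotoneSupport Mat L K → EntryIsOverlap Mat L K i j
staircase Mat L K i j i<L j<K mono with m≤n⇒∃[o]m+o≡n i<L | m≤n⇒∃[o]m+o≡n j<K
... | e , refl | e' , refl =
  subst₂ (λ L K → EntryIsOverlap Mat L K i j) (+-suc i e) (+-suc j e')
    (Staircase.entry Mat i e j e' (subst₂ (MonotoneSupport Mat) (sym (+-suc i e)) (sym (+-suc j e')) mono))

-- Positions 0, …, n of the marked points and a chord cutting off [p, q].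
module Interval (n p q : ℕ) (p<q : p < q) (q≤n : q ≤ n) where

  N L K : ℕ
  N = suc n
  L = suc (q ∸ p)
  K = p + (n ∸ q)

  inner : ℕ → Bool
  inner k = (p ≤ᵇ k) ∧ (k ≤ᵇ q)

  inner-true : ∀ {k} → p ≤ k → k ≤ q → inner k ≡ true
  inner-true p≤k k≤q rewrite ≤ᵇ-true p≤k | ≤ᵇ-true k≤q = refl

  inner-false-below : ∀ {k} → k < p → inner k ≡ false
  inner-false-below k<p rewrite ≤ᵇ-false k<p = refl

  inner-false-above : ∀ {k} → q < k → inner k ≡ false
  inner-false-above {k} q<k with p ≤ᵇ k
  ... | true  = ≤ᵇ-false q<k
  ... | false = refl

  inner-true⁻¹ : ∀ {k} → inner k ≡ true → p ≤ k × k ≤ q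
  inner-true⁻¹ {k} eq with p ≤ᵇ k in e₁ | k ≤ᵇ q in e₂
  inner-true⁻¹ refl | true | true = ≤ᵇ-true⁻¹ e₁ , ≤ᵇ-true⁻¹ e₂

  inner-false⁻¹ : ∀ {k} → inner k ≡ false → k < p ⊎ q < k
  inner-false⁻¹ {k} eq with p ≤ᵇ k in e₁ | k ≤ᵇ q in e₂
  inner-false⁻¹ refl | false | _     = inj₁ (≤ᵇ-false⁻¹ e₁)
  inner-false⁻¹ refl | true  | false = inj₂ (≤ᵇ-false⁻¹ e₂)

  p≤q : p ≤ q
  p≤q = <⇒≤ p<q

  p+L≡1+q : p + L ≡ suc q
  p+L≡1+q = trans (+-suc p (q ∸ p)) (cong suc (m+[n∸m]≡n p≤q))

  p+k≤q : ∀ k → k < L → p + k ≤ q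
  p+k≤q k k<L = ≤-trans (+-monoʳ-≤ p (s≤s⁻¹ k<L)) (≤-reflexive (m+[n∸m]≡n p≤q))

  inner-middle : ∀ k → k < L → inner (p + k) ≡ true
  inner-middle k k<L = inner-true (m≤m+n p k) (p+k≤q k k<L)

  inner-above : ∀ k → inner (p + (L + k)) ≡ false
  inner-above k = inner-false-above (≤-trans (≤-reflexive (sym p+L≡1+q))
                                             (≤-trans (m≤m+n (p + L) k) (≤-reflexive (+-assoc p L k))))

  inner-offset : ∀ a → inner a ≡ true → a ∸ p < L × p + (a ∸ p) ≡ a
  inner-offset a e with inner-true⁻¹ e
  ... | p≤a , a≤q = s≤s (∸-monoˡ-≤ p a≤q) , m+[n∸m]≡n p≤a

  Σ<-blocks : ∀ (g : ℕ → ℕ) → Σ< N g ≡ Σ< p g + (Σ< L (λ k → g (p + k)) + Σ< (n ∸ q) (λ k → g (p + (L + k))))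
  Σ<-blocks g = trans (cong (λ z → Σ< z g) N≡p+L+d)
                      (trans (Σ<-split p (L + (n ∸ q)) g) (cong (Σ< p g +_) (Σ<-split L (n ∸ q) (λ k → g (p + k)))))
    where
    N≡p+L+d : N ≡ p + (L + (n ∸ q))
    N≡p+L+d = trans (cong suc (sym (m+[n∸m]≡n q≤n))) (trans (cong (_+ (n ∸ q)) (sym p+L≡1+q)) (+-assoc p L (n ∸ q)))

  Σ-inner : ∀ (f : ℕ → ℕ) → Σ< N (λ s → when (inner s) (f s)) ≡ Σ< L (λ k → f (p + k))
  Σ-inner f = begin
    Σ< N g
      ≡⟨ Σ<-blocks g ⟩
    Σ< p g + (Σ< L (λ k → g (p + k)) + Σ< (n ∸ q) (λ k → g (p + (L + k))))
      ≡⟨ cong₂ _+_ (Σ<-zero p (λ k k<p → cong (λ b → when b (f k)) (inner-false-below k<p)))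
                   (cong₂ _+_ (Σ<-cong L (λ k k<L → cong (λ b → when b (f (p + k))) (inner-middle k k<L)))
                              (Σ<-zero (n ∸ q) (λ k _ → cong (λ b → when b (f (p + (L + k)))) (inner-above k)))) ⟩
    Σ< L (λ k → f (p + k)) + 0
      ≡⟨ +-identityʳ _ ⟩
    Σ< L (λ k → f (p + k))
      ∎
    where
    open ≡-Reasoning
    g : ℕ → ℕ
    g s = when (inner s) (f s)

  -- The outer positions in the order in which their arcs meet the chord, starting next to p:
  -- p−1, …, 0, n, …, q+1.
  outer : ℕ → ℕ
  outer k = if k <ᵇ p then p ∸ suc k else n ∸ (k ∸ p)

  outer-below : ∀ k → k < p → outer k ≡ p ∸ suc k
  outer-below k k<p = cong (λ b → if b then p ∸ suc k else n ∸ (k ∸ p)) (<ᵇ-true k<p)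

  outer-above : ∀ k → outer (p + k) ≡ n ∸ k
  outer-above k = cong₂ (λ b x → if b then p ∸ suc (p + k) else n ∸ x) (<ᵇ-false (m≤m+n p k)) (m+n∸m≡n p k)

  reversed-above : ∀ k → k < n ∸ q → p + (L + ((n ∸ q) ∸ suc k)) ≡ n ∸ k
  reversed-above k k<d with m≤n⇒∃[o]m+o≡n k<d
  ... | e , d≡ = begin
    p + (L + ((n ∸ q) ∸ suc k))       ≡⟨ sym (+-assoc p L _) ⟩
    p + L + ((n ∸ q) ∸ suc k)         ≡⟨ cong₂ (λ a b → a + (b ∸ suc k)) p+L≡1+q (sym d≡) ⟩
    suc q + ((suc k + e) ∸ suc k)     ≡⟨ cong (suc q +_) (m+n∸m≡n (suc k) e) ⟩
    suc q + e                         ≡⟨ sym (m+n∸m≡n k (suc q + e)) ⟩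
    k + (suc q + e) ∸ k               ≡⟨ cong (_∸ k) (solve 3 (λ q k e → k :+ (con 1 :+ q :+ e) := q :+ (con 1 :+ k :+ e)) refl q k e) ⟩
    q + (suc k + e) ∸ k               ≡⟨ cong (λ d → q + d ∸ k) d≡ ⟩
    q + (n ∸ q) ∸ k                   ≡⟨ cong (_∸ k) (m+[n∸m]≡n q≤n) ⟩
    n ∸ k                             ∎
    where open ≡-Reasoning

  Σ-outer : ∀ (f : ℕ → ℕ) → Σ< N (λ s → when (not (inner s)) (f s)) ≡ Σ< K (λ k → f (outer k))
  Σ-outer f = begin
    Σ< N g
      ≡⟨ Σ<-blocks g ⟩
    Σ< p g + (Σ< L (λ k → g (p + k)) + Σ< (n ∸ q) (λ k → g (p + (L + k))))
      ≡⟨ cong₂ _+_ (Σ<-cong p (λ k k<p → cong (λ b → when (not b) (f k)) (inner-false-below k<p)))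
                   (cong₂ _+_ (Σ<-zero L (λ k k<L → cong (λ b → when (not b) (f (p + k))) (inner-middle k k<L)))
                              (Σ<-cong (n ∸ q) (λ k _ → cong (λ b → when (not b) (f (p + (L + k)))) (inner-above k)))) ⟩
    Σ< p f + (0 + Σ< (n ∸ q) (λ k → f (p + (L + k))))
      ≡⟨ cong₂ _+_ (Σ<-reverse p f) (Σ<-reverse (n ∸ q) (λ k → f (p + (L + k)))) ⟩
    Σ< p (λ k → f (p ∸ suc k)) + Σ< (n ∸ q) (λ k → f (p + (L + ((n ∸ q) ∸ suc k))))
      ≡⟨ cong₂ _+_ (Σ<-cong p (λ k k<p → cong f (sym (outer-below k k<p))))
                   (Σ<-cong (n ∸ q) (λ k k<d → cong f (trans (reversed-above k k<d) (sym (outer-above k))))) ⟩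
    Σ< p (λ k → f (outer k)) + Σ< (n ∸ q) (λ k → f (outer (p + k)))
      ≡⟨ sym (Σ<-split p (n ∸ q) (λ k → f (outer k))) ⟩
    Σ< K (λ k → f (outer k))
      ∎
    where
    open ≡-Reasoning
    g : ℕ → ℕ
    g s = when (not (inner s)) (f s)

  q<n∸k : ∀ k → k < n ∸ q → q < n ∸ k
  q<n∸k k k<d = ≤-trans (≤-reflexive (sym p+L≡1+q))
    (≤-trans (m≤m+n (p + L) _) (≤-reflexive (trans (+-assoc p L _) (reversed-above k k<d))))

  data OuterIndex (k : ℕ) : Set where
    before : k < p → OuterIndex k
    after  : ∀ j → j < n ∸ q → k ≡ p + j → OuterIndex k

  outer-index : ∀ k → k < K → OuterIndex k
  outer-index k k<K with k <? p
  ... | yes k<p = before k<p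
  ... | no  k≮p with m≤n⇒∃[o]m+o≡n (≮⇒≥ k≮p)
  ...   | j , refl = after j (+-cancelˡ-< p j (n ∸ q) k<K) refl

  outer≤n : ∀ k → k < K → outer k ≤ n
  outer≤n k k<K with outer-index k k<K
  ... | before k<p         = ≤-trans (≤-reflexive (outer-below k k<p)) (≤-trans (m∸n≤m p (suc k)) (≤-trans p≤q q≤n))
  ... | after j _ refl     = ≤-trans (≤-reflexive (outer-above j)) (m∸n≤m n j)

  outer-not-inner : ∀ k → k < K → inner (outer k) ≡ false
  outer-not-inner k k<K with outer-index k k<K
  ... | before k<p     rewrite outer-below k k<p = inner-false-below (∸-monoʳ-< {p} {suc k} {0} z<s k<p)
  ... | after j j<d refl rewrite outer-above j    = inner-false-above (q<n∸k j j<d)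

  outer-surjective : ∀ u → u ≤ n → inner u ≡ false → ∃ λ k → k < K × outer k ≡ u
  outer-surjective u u≤n e with inner-false⁻¹ e
  ... | inj₁ u<p = p ∸ suc u , ≤-trans k<p (m≤m+n p _) ,
        trans (outer-below (p ∸ suc u) k<p) (trans (cong (p ∸_) (sym (+-∸-assoc 1 u<p))) (m∸[m∸n]≡n (<⇒≤ u<p)))
    where
    k<p : p ∸ suc u < p
    k<p = ∸-monoʳ-< {p} {suc u} {0} z<s u<p
  ... | inj₂ q<u = p + (n ∸ u) , +-monoʳ-< p (∸-monoʳ-< q<u u≤n) , trans (outer-above (n ∸ u)) (m∸[m∸n]≡n u≤n)

  rank : ℕ → ℕ
  rank u = if u <ᵇ p then p ∸ u else p + suc (n ∸ u)

  rank-below : ∀ {u} → u < p → rank u ≡ p ∸ u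
  rank-below {u} u<p = cong (λ b → if b then p ∸ u else p + suc (n ∸ u)) (<ᵇ-true u<p)

  rank-above : ∀ {u} → p ≤ u → rank u ≡ p + suc (n ∸ u)
  rank-above {u} p≤u = cong (λ b → if b then p ∸ u else p + suc (n ∸ u)) (<ᵇ-false p≤u)

  rank-outer : ∀ k → k < K → rank (outer k) ≡ suc k
  rank-outer k k<K with outer-index k k<K
  ... | before k<p rewrite outer-below k k<p =
    trans (rank-below (∸-monoʳ-< {p} {suc k} {0} z<s k<p)) (m∸[m∸n]≡n k<p)
  ... | after j j<d refl rewrite outer-above j =
    trans (rank-above (≤-trans p≤q (<⇒≤ (q<n∸k j j<d))))
          (trans (cong (λ x → p + suc x) (m∸[m∸n]≡n (≤-trans (<⇒≤ j<d) (m∸n≤m n q)))) (+-suc p j))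

  rank-below-<⁻¹ : ∀ {v v'} → v < p → v' < p → rank v' < rank v → v < v'
  rank-below-<⁻¹ {v} {v'} v<p v'<p r< = ∸-cancelʳ-< {o = p} (subst₂ _<_ (rank-below v'<p) (rank-below v<p) r<)

  rank-above-<⁻¹ : ∀ {v v'} → p ≤ v → p ≤ v' → rank v' < rank v → v < v'
  rank-above-<⁻¹ {v} {v'} p≤v p≤v' r< =
    ∸-cancelʳ-< {o = n} (s≤s⁻¹ (+-cancelˡ-< p _ _ (subst₂ _<_ (rank-above p≤v') (rank-above p≤v) r<)))

  rank-below≤above : ∀ {v v'} → v < p → p ≤ v' → rank v ≤ rank v'
  rank-below≤above {v} {v'} v<p p≤v' =
    ≤-trans (≤-reflexive (rank-below v<p)) (≤-trans (m∸n≤m p v) (≤-trans (m≤m+n p _) (≤-reflexive (sym (rank-above p≤v')))))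

  rank-above-antitone : ∀ {v v'} → p ≤ v → v ≤ v' → rank v' ≤ rank v
  rank-above-antitone {v} {v'} p≤v v≤v' = subst₂ _≤_ (sym (rank-above (≤-trans p≤v v≤v'))) (sym (rank-above p≤v))
    (+-monoʳ-≤ p (s≤s (∸-monoʳ-≤ n v≤v')))

  -- The consequence of non-crossing that the rejoining formula relies on.
  MonotoneAcross : (ℕ → ℕ → ℕ) → Set
  MonotoneAcross M = ∀ a a' b b' → p ≤ a → a < a' → a' ≤ q → b ≤ n → b' ≤ n → inner b ≡ false → inner b' ≡ false →
                     0 < M a b → 0 < M a' b' → rank b ≤ rank b'

  reflect : ℕ → ℕ
  reflect k = if inner k then p + q ∸ k else k

  reflect-outer : ∀ {k} → inner k ≡ false → reflect k ≡ k
  reflect-outer {k} e = cong (λ b → if b then p + q ∸ k else k) e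

  reflect-inner : ∀ {k} → inner k ≡ true → reflect k ≡ p + q ∸ k
  reflect-inner {k} e = cong (λ b → if b then p + q ∸ k else k) e

  reflect-p : reflect p ≡ q
  reflect-p = trans (reflect-inner (inner-true ≤-refl p≤q)) (m+n∸m≡n p q)

  reflect-q : reflect q ≡ p
  reflect-q = trans (reflect-inner (inner-true p≤q ≤-refl)) (m+n∸n≡m p q)

  reflect-middle : ∀ k → k < L → reflect (p + k) ≡ q ∸ k
  reflect-middle k k<L = trans (reflect-inner (inner-middle k k<L)) ([m+n]∸[m+o]≡n∸o p q k)

  inner-reflect : ∀ k → inner (reflect k) ≡ inner k
  inner-reflect k with inner k in e
  ... | false = e
  ... | true with inner-true⁻¹ e
  ...   | p≤k , k≤q = inner-true (≤-trans (≤-reflexive (sym (m+n∸n≡m p q))) (∸-monoʳ-≤ (p + q) k≤q))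
                                 (≤-trans (∸-monoʳ-≤ (p + q) p≤k) (≤-reflexive (m+n∸m≡n p q)))

  reflect-involutive : ∀ k → reflect (reflect k) ≡ k
  reflect-involutive k with inner k in e
  ... | false = reflect-outer e
  ... | true  = trans (reflect-inner (trans (cong inner (sym (reflect-inner e))) (trans (inner-reflect k) e)))
                      (m∸[m∸n]≡n (≤-trans (proj₂ (inner-true⁻¹ e)) (m≤n+m q p)))

  reflect-<-anti : ∀ a b → inner a ≡ true → inner b ≡ true → a < b → reflect b < reflect a
  reflect-<-anti a b ea eb a<b = subst₂ _<_ (sym (reflect-inner eb)) (sym (reflect-inner ea))
    (∸-monoʳ-< a<b (≤-trans (proj₂ (inner-true⁻¹ eb)) (m≤n+m q p)))

  reflect-bounds : ∀ a → inner a ≡ true → p ≤ reflect a × reflect a ≤ q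
  reflect-bounds a ea = inner-true⁻¹ (trans (inner-reflect a) ea)

  inner-adjacent : q ≡ suc p → ∀ {a} → inner a ≡ true → a ≡ p ⊎ a ≡ q
  inner-adjacent q≡1+p ea with inner-true⁻¹ ea
  ... | p≤a , a≤q with m≤n⇒m<n∨m≡n p≤a
  ...   | inj₂ p≡a = inj₁ (sym p≡a)
  ...   | inj₁ p<a = inj₂ (≤-antisym a≤q (subst (_≤ _) (sym q≡1+p) p<a))

  reflect-adjacent-fixes : q ≡ suc p → ∀ k → k ≢ p → k ≢ q → reflect k ≡ k
  reflect-adjacent-fixes q≡1+p k k≢p k≢q with inner k in e
  ... | false = refl
  ... | true with inner-adjacent q≡1+p e
  ...   | inj₁ k≡p = ⊥-elim (k≢p k≡p)
  ...   | inj₂ k≡q = ⊥-elim (k≢q k≡q)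

  reflect≤n : ∀ k → k ≤ n → reflect k ≤ n
  reflect≤n k k≤n with inner k in e
  ... | false = k≤n
  ... | true  = ≤-trans (∸-monoʳ-≤ (p + q) (proj₁ (inner-true⁻¹ e))) (≤-trans (≤-reflexive (m+n∸m≡n p q)) q≤n)

  Σ-inner-reflect : ∀ (f : ℕ → ℕ) → Σ< N (λ u → when (inner u) (f (reflect u))) ≡ Σ< N (λ u → when (inner u) (f u))
  Σ-inner-reflect f = begin
    Σ< N (λ u → when (inner u) (f (reflect u)))   ≡⟨ Σ-inner (λ u → f (reflect u)) ⟩
    Σ< L (λ k → f (reflect (p + k)))              ≡⟨ Σ<-cong L (λ k k<L → cong f (reflect-middle k k<L)) ⟩
    Σ< L (λ k → f (q ∸ k))                        ≡⟨ Σ<-reverse L (λ k → f (q ∸ k)) ⟩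
    Σ< L (λ k → f (q ∸ (L ∸ suc k)))              ≡⟨ Σ<-cong L (λ k k<L → cong f (q∸[q∸p∸k] k (s≤s⁻¹ k<L))) ⟩
    Σ< L (λ k → f (p + k))                        ≡⟨ sym (Σ-inner f) ⟩
    Σ< N (λ u → when (inner u) (f u))             ∎
    where
    open ≡-Reasoning
    q∸[q∸p∸k] : ∀ k → k ≤ q ∸ p → q ∸ (q ∸ p ∸ k) ≡ p + k
    q∸[q∸p∸k] k k≤ with m≤n⇒∃[o]m+o≡n k≤
    ... | e , eq = begin
      q ∸ (q ∸ p ∸ k)            ≡⟨ cong (λ z → q ∸ (z ∸ k)) (sym eq) ⟩
      q ∸ (k + e ∸ k)            ≡⟨ cong (q ∸_) (m+n∸m≡n k e) ⟩
      q ∸ e                      ≡⟨ cong (_∸ e) (trans (sym (m+[n∸m]≡n p≤q)) (cong (p +_) (sym eq))) ⟩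
      p + (k + e) ∸ e            ≡⟨ cong (_∸ e) (sym (+-assoc p k e)) ⟩
      p + k + e ∸ e              ≡⟨ m+n∸n≡m (p + k) e ⟩
      p + k                      ∎

  Σ-inner+outer : ∀ (f : ℕ → ℕ) → Σ< N f ≡ Σ< N (λ u → when (inner u) (f u)) + Σ< N (λ u → when (not (inner u)) (f u))
  Σ-inner+outer f = trans (Σ<-cong N (λ u _ → split u)) (Σ<-+ N (λ u → when (inner u) (f u)) (λ u → when (not (inner u)) (f u)))
    where
    split : ∀ u → f u ≡ when (inner u) (f u) + when (not (inner u)) (f u)
    split u with inner u
    ... | true  = sym (+-identityʳ (f u))
    ... | false = refl

  Σ-when-pos : ∀ (P : ℕ → Bool) (f : ℕ → ℕ) → 0 < Σ< N (λ u → when (P u) (f u)) → ∃ λ u → u ≤ n × P u ≡ true × 0 < f u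
  Σ-when-pos P f pos with Σ<-pos⇒term-pos N (λ u → when (P u) (f u)) pos
  ... | u , u<N , pu with when-pos (P u) (f u) pu
  ...   | e , fu>0 = u , s≤s⁻¹ u<N , e , fu>0

  when-inner-cong : ∀ u {x y} → (inner u ≡ true → x ≡ y) → when (inner u) x ≡ when (inner u) y
  when-inner-cong u x≡y with inner u
  ... | true  = x≡y refl
  ... | false = refl

  when-outer-cong : ∀ u {x y} → (inner u ≡ false → x ≡ y) → when (not (inner u)) x ≡ when (not (inner u)) y
  when-outer-cong u x≡y with inner u
  ... | true  = refl
  ... | false = x≡y refl

-- The action on arc matrices

Symmetric : ℕ → (ℕ → ℕ → ℕ) → Set
Symmetric n M = ∀ a b → a ≤ n → b ≤ n → M a b ≡ M b a

Loopless : (ℕ → ℕ → ℕ) → Set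
Loopless M = ∀ a → M a a ≡ 0

NonCrossing : ℕ → (ℕ → ℕ → ℕ) → Set
NonCrossing n M = ∀ a b c d → a < b → b < c → c < d → d ≤ n → M a c ≡ 0 ⊎ M b d ≡ 0

Arc : (ℕ → ℕ → ℕ) → ℕ → ℕ → Set
Arc M a b = 0 < M a b

Arc-flip : ∀ {n M a b} → Symmetric n M → a ≤ n → b ≤ n → Arc M a b → Arc M b a
Arc-flip symM a≤n b≤n = subst (0 <_) (symM _ _ a≤n b≤n)

¬crossing : ∀ {n M a b c d} → NonCrossing n M → a < b → b < c → c < d → d ≤ n → Arc M a c → Arc M b d → ⊥
¬crossing {a = a} {b} {c} {d} nc a<b b<c c<d d≤n ac bd with nc a b c d a<b b<c c<d d≤n
... | inj₁ e = <⇒≢ ac (sym e)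
... | inj₂ e = <⇒≢ bd (sym e)

-- The action of s_{p,q} of Defs, transported to arc-count matrices indexed by positions in ℕ.
module Rejoin (n p q : ℕ) (p<q : p < q) (q≤n : q ≤ n) where
  open Interval n p q p<q q≤n public

  module Formula (M : ℕ → ℕ → ℕ) where

    cdIn cdOut cdIn' A B : ℕ → ℕ
    cdIn k  = Σ< N (λ u → when (not (inner u)) (M k u))
    cdOut u = Σ< N (λ t → when (inner t) (M u t))
    cdIn' k = cdIn (reflect k)
    A k     = Σ< N (λ s → when (inner s ∧ (s ≤ᵇ k)) (cdIn' s))
    B u     = Σ< N (λ v → when (not (inner v) ∧ (rank v ≤ᵇ rank u)) (cdOut v))

    cross : ℕ → ℕ → ℕ
    cross a b = overlapLen (A a ∸ cdIn' a) (A a) (B b ∸ cdOut b) (B b)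

    newArc : ℕ → ℕ → ℕ
    newArc a b = if inner a then (if inner b then M (reflect a) (reflect b) else cross a b)
                            else (if inner b then cross b a else M a b)

    cross-pos⇒cdIn'-pos : ∀ {a b} → 0 < cross a b → 0 < cdIn' a
    cross-pos⇒cdIn'-pos {a} {b} pos = ∸<⇒pos (proj₁ (proj₁ (overlapLen-pos _ _ (B b ∸ cdOut b) (B b) pos)))

    cross-pos⇒cdOut-pos : ∀ {a b} → 0 < cross a b → 0 < cdOut b
    cross-pos⇒cdOut-pos {a} {b} pos = ∸<⇒pos (proj₂ (proj₂ (overlapLen-pos (A a ∸ cdIn' a) (A a) _ _ pos)))

    newArc-by-cases : ∀ a b {v} →
      (inner a ≡ true → inner b ≡ true → M (reflect a) (reflect b) ≡ v) → (inner a ≡ true → inner b ≡ false → cross a b ≡ v) →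
      (inner a ≡ false → inner b ≡ true → cross b a ≡ v) → (inner a ≡ false → inner b ≡ false → M a b ≡ v) → newArc a b ≡ v
    newArc-by-cases a b ii io oi oo with inner a | inner b
    ... | true  | true  = ii refl refl
    ... | true  | false = io refl refl
    ... | false | true  = oi refl refl
    ... | false | false = oo refl refl

    newArc-inner-inner : ∀ {a b} → inner a ≡ true → inner b ≡ true → newArc a b ≡ M (reflect a) (reflect b)
    newArc-inner-inner ea eb rewrite ea | eb = refl

    newArc-inner-outer : ∀ {a b} → inner a ≡ true → inner b ≡ false → newArc a b ≡ cross a b
    newArc-inner-outer ea eb rewrite ea | eb = refl

    newArc-outer-inner : ∀ {a b} → inner a ≡ false → inner b ≡ true → newArc a b ≡ cross b a
    newArc-outer-inner ea eb rewrite ea | eb = refl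

    newArc-outer-outer : ∀ {a b} → inner a ≡ false → inner b ≡ false → newArc a b ≡ M a b
    newArc-outer-outer ea eb rewrite ea | eb = refl

    newArc-sym : Symmetric n M → Symmetric n newArc
    newArc-sym symM a b a≤n b≤n = newArc-by-cases a b
      (λ ea eb → trans (symM _ _ (reflect≤n a a≤n) (reflect≤n b b≤n)) (sym (newArc-inner-inner eb ea)))
      (λ ea eb → sym (newArc-outer-inner eb ea))
      (λ ea eb → sym (newArc-inner-outer eb ea))
      (λ ea eb → trans (symM a b a≤n b≤n) (sym (newArc-outer-outer eb ea)))

    newArc-loopless : Loopless M → Loopless newArc
    newArc-loopless loop a = newArc-by-cases a a (λ _ _ → loop (reflect a)) (λ ea ea' → ⊥-elim (true≢false ea ea'))
                                               (λ ea ea' → ⊥-elim (true≢false ea' ea)) (λ _ _ → loop a)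
      where
      true≢false : ∀ {b} → b ≡ true → b ≡ false → ⊥
      true≢false refl ()

    inCount inCount' outCount : ℕ → ℕ
    inCount k  = cdIn (p + k)
    inCount' k = cdIn' (p + k)
    outCount k = cdOut (outer k)

    A-prefix : ∀ i → i < L → A (p + i) ≡ Σ< (suc i) inCount'
    A-prefix i i<L = begin
      A (p + i)
        ≡⟨ Σ<-cong N (λ s _ → when-∧ (inner s) (s ≤ᵇ p + i) (cdIn' s)) ⟩
      Σ< N (λ s → when (inner s) (when (s ≤ᵇ p + i) (cdIn' s)))
        ≡⟨ Σ-inner (λ s → when (s ≤ᵇ p + i) (cdIn' s)) ⟩
      Σ< L (λ k → when (p + k ≤ᵇ p + i) (inCount' k))
        ≡⟨ Σ<-cong L (λ k _ → cong (λ b → when b (inCount' k)) (+-≤ᵇ-+ p k i)) ⟩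
      Σ< L (λ k → when (k ≤ᵇ i) (inCount' k))
        ≡⟨ Σ<-when-≤ᵇ L i inCount' i<L ⟩
      Σ< (suc i) inCount'
        ∎
      where open ≡-Reasoning

    B-prefix : ∀ j → j < K → B (outer j) ≡ Σ< (suc j) outCount
    B-prefix j j<K = begin
      B (outer j)
        ≡⟨ Σ<-cong N (λ v _ → when-∧ (not (inner v)) (rank v ≤ᵇ rank (outer j)) (cdOut v)) ⟩
      Σ< N (λ v → when (not (inner v)) (when (rank v ≤ᵇ rank (outer j)) (cdOut v)))
        ≡⟨ Σ-outer (λ v → when (rank v ≤ᵇ rank (outer j)) (cdOut v)) ⟩
      Σ< K (λ k → when (rank (outer k) ≤ᵇ rank (outer j)) (outCount k))
        ≡⟨ Σ<-cong K (λ k k<K → cong (λ b → when b (outCount k))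
                       (trans (cong₂ _≤ᵇ_ (rank-outer k k<K) (rank-outer j j<K)) (+-≤ᵇ-+ 1 k j))) ⟩
      Σ< K (λ k → when (k ≤ᵇ j) (outCount k))
        ≡⟨ Σ<-when-≤ᵇ K j outCount j<K ⟩
      Σ< (suc j) outCount
        ∎
      where open ≡-Reasoning

    cross-prefix : ∀ i j → i < L → j < K →
      cross (p + i) (outer j) ≡ overlapLen (Σ< i inCount') (Σ< (suc i) inCount') (Σ< j outCount) (Σ< (suc j) outCount)
    cross-prefix i j i<L j<K rewrite A-prefix i i<L | B-prefix j j<K
      | Σ<-suc-∸ i inCount' | Σ<-suc-∸ j outCount = refl

  -- The rejoined arcs do not cross: the arc from the first inner point to the first
  -- outer point blocks every arc from a later inner point to a later outer point.
  module NoCrossingRejoin (M : ℕ → ℕ → ℕ) where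
    open Formula M

    ¬cross-out-of-order : ∀ i j → i < L → j < K → 1 ≤ i → 1 ≤ j →
                          0 < cross (p + i) (outer 0) → 0 < cross (p + 0) (outer j) → ⊥
    ¬cross-out-of-order i j i<L j<K 1≤i 1≤j pos pos' = <-irrefl refl (begin-strict
      Σ< 1 inCount'   ≤⟨ Σ<-monoˡ-≤ inCount' 1≤i ⟩
      Σ< i inCount'   <⟨ proj₂ (proj₁ (overlapLen-pos (Σ< i inCount') (Σ< (suc i) inCount') 0 (Σ< 1 outCount) (subst (0 <_) (cross-prefix i 0 i<L (≤-trans (s≤s z≤n) j<K)) pos))) ⟩
      Σ< 1 outCount   ≤⟨ Σ<-monoˡ-≤ outCount 1≤j ⟩
      Σ< j outCount   <⟨ proj₁ (proj₂ (overlapLen-pos 0 (Σ< 1 inCount') (Σ< j outCount) (Σ< (suc j) outCount) (subst (0 <_) (cross-prefix 0 j z<s j<K) pos'))) ⟩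
      Σ< 1 inCount'   ∎)
      where open ≤-Reasoning

  module Conservation (M : ℕ → ℕ → ℕ) (symM : Symmetric n M) where
    open Formula M

    Σ-inCount'≡Σ-outCount : Σ< L inCount' ≡ Σ< K outCount
    Σ-inCount'≡Σ-outCount = begin
      Σ< L (λ k → cdIn (reflect (p + k)))
        ≡⟨ sym (Σ-inner (λ u → cdIn (reflect u))) ⟩
      Σ< N (λ u → when (inner u) (cdIn (reflect u)))
        ≡⟨ Σ-inner-reflect cdIn ⟩
      Σ< N (λ u → when (inner u) (cdIn u))
        ≡⟨ Σ-inner cdIn ⟩
      Σ< L (λ k → cdIn (p + k))
        ≡⟨ Σ<-cong L (λ k _ → Σ-outer (M (p + k))) ⟩
      Σ< L (λ k → Σ< K (λ j → M (p + k) (outer j)))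
        ≡⟨ Σ<-comm L K (λ k j → M (p + k) (outer j)) ⟩
      Σ< K (λ j → Σ< L (λ k → M (p + k) (outer j)))
        ≡⟨ Σ<-cong K (λ j j<K → Σ<-cong L (λ k k<L → symM _ _ (≤-trans (p+k≤q k k<L) q≤n) (outer≤n j j<K))) ⟩
      Σ< K (λ j → Σ< L (λ k → M (outer j) (p + k)))
        ≡⟨ Σ<-cong K (λ j _ → sym (Σ-inner (M (outer j)))) ⟩
      Σ< K outCount
        ∎
      where open ≡-Reasoning

    Σ-inner-cross : ∀ j → j < K → Σ< N (λ a → when (inner a) (cross a (outer j))) ≡ outCount j
    Σ-inner-cross j j<K = begin
      Σ< N (λ a → when (inner a) (cross a (outer j)))
        ≡⟨ Σ-inner (λ a → cross a (outer j)) ⟩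
      Σ< L (λ k → cross (p + k) (outer j))
        ≡⟨ Σ<-cong L (λ k k<L → cross-prefix k j k<L j<K) ⟩
      Σ< L (λ k → overlapLen (Σ< k inCount') (Σ< (suc k) inCount') (Σ< j outCount) (Σ< (suc j) outCount))
        ≡⟨ Σ<-overlapLen-cell inCount' outCount L j
             (≤-trans (Σ<-monoˡ-≤ outCount j<K) (≤-reflexive (sym Σ-inCount'≡Σ-outCount))) ⟩
      outCount j
        ∎
      where open ≡-Reasoning

    Σ-outer-cross : ∀ i → i < L → Σ< N (λ b → when (not (inner b)) (cross (p + i) b)) ≡ inCount' i
    Σ-outer-cross i i<L = begin
      Σ< N (λ b → when (not (inner b)) (cross (p + i) b))
        ≡⟨ Σ-outer (cross (p + i)) ⟩
      Σ< K (λ k → cross (p + i) (outer k))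
        ≡⟨ Σ<-cong K (λ k k<K → trans (cross-prefix i k i<L k<K) (overlapLen-comm (Σ< i inCount') (Σ< (suc i) inCount') (Σ< k outCount) (Σ< (suc k) outCount))) ⟩
      Σ< K (λ k → overlapLen (Σ< k outCount) (Σ< (suc k) outCount) (Σ< i inCount') (Σ< (suc i) inCount'))
        ≡⟨ Σ<-overlapLen-cell outCount inCount' K i
             (≤-trans (Σ<-monoˡ-≤ inCount' i<L) (≤-reflexive Σ-inCount'≡Σ-outCount)) ⟩
      inCount' i
        ∎
      where open ≡-Reasoning

  module Reconstruction (M : ℕ → ℕ → ℕ) (symM : Symmetric n M) (mono : MonotoneAcross M) where
    open Formula M

    M-staircase : ∀ i j → i < L → j < K →
      M (p + i) (outer j) ≡ overlapLen (Σ< i inCount) (Σ< (suc i) inCount) (Σ< j outCount) (Σ< (suc j) outCount)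
    M-staircase i j i<L j<K =
      trans (staircase Mat L K i j i<L j<K monotone)
            (cong₄ overlapLen (Σ<-cong i (λ a _ → row a)) (Σ<-cong (suc i) (λ a _ → row a))
                              (Σ<-cong j (λ b b<j → col b (<-trans b<j j<K))) (Σ<-cong (suc j) (λ b b≤j → col b (≤-trans b≤j j<K))))
      where
      Mat : ℕ → ℕ → ℕ
      Mat k j = M (p + k) (outer j)
      row : ∀ a → Σ< K (Mat a) ≡ inCount a
      row a = sym (Σ-outer (M (p + a)))
      col : ∀ b → b < K → Σ< L (λ a → Mat a b) ≡ outCount b
      col b b<K = trans (Σ<-cong L (λ a a<L → symM _ _ (≤-trans (p+k≤q a a<L) q≤n) (outer≤n b b<K)))
                        (sym (Σ-inner (M (outer b))))
      monotone : MonotoneSupport Mat L K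
      monotone a a' b b' a<a' a'<L b<K b'<K pos pos' =
        s≤s⁻¹ (subst₂ _≤_ (rank-outer b b<K) (rank-outer b' b'<K)
          (mono (p + a) (p + a') (outer b) (outer b') (m≤m+n p a) (+-monoʳ-< p a<a') (p+k≤q a' a'<L)
                (outer≤n b b<K) (outer≤n b' b'<K) (outer-not-inner b b<K) (outer-not-inner b' b'<K) pos pos'))

    cross-reconstructs : ∀ (M' : ℕ → ℕ → ℕ) →
      (∀ k → k < L → Formula.inCount' M' k ≡ inCount k) → (∀ j → j < K → Formula.outCount M' j ≡ outCount j) →
      ∀ a b → b ≤ n → inner a ≡ true → inner b ≡ false → Formula.cross M' a b ≡ M a b
    cross-reconstructs M' in≗ out≗ a b b≤n ea eb with inner-offset a ea | outer-surjective b b≤n eb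
    ... | i<L , a≡ | j , j<K , b≡ = subst₂ (λ a b → M'.cross a b ≡ M a b) a≡ b≡ (on-grid (a ∸ p) j i<L j<K)
      where
      module M' = Formula M'
      on-grid : ∀ i j → i < L → j < K → M'.cross (p + i) (outer j) ≡ M (p + i) (outer j)
      on-grid i j i<L j<K = begin
        M'.cross (p + i) (outer j)
          ≡⟨ M'.cross-prefix i j i<L j<K ⟩
        overlapLen (Σ< i M'.inCount') (Σ< (suc i) M'.inCount') (Σ< j M'.outCount) (Σ< (suc j) M'.outCount)
          ≡⟨ cong₂ (λ x y → overlapLen x y (Σ< j M'.outCount) (Σ< (suc j) M'.outCount))
                   (Σ<-cong i (λ k k<i → in≗ k (<-trans k<i i<L))) (Σ<-cong (suc i) (λ k k≤i → in≗ k (≤-trans k≤i i<L))) ⟩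
        overlapLen (Σ< i inCount) (Σ< (suc i) inCount) (Σ< j M'.outCount) (Σ< (suc j) M'.outCount)
          ≡⟨ cong₂ (overlapLen (Σ< i inCount) (Σ< (suc i) inCount))
                   (Σ<-cong j (λ k k<j → out≗ k (<-trans k<j j<K))) (Σ<-cong (suc j) (λ k k≤j → out≗ k (≤-trans k≤j j<K))) ⟩
        overlapLen (Σ< i inCount) (Σ< (suc i) inCount) (Σ< j outCount) (Σ< (suc j) outCount)
          ≡⟨ sym (M-staircase i j i<L j<K) ⟩
        M (p + i) (outer j)
          ∎
        where open ≡-Reasoning

  module Congruence (M M' : ℕ → ℕ → ℕ) (M≗M' : ∀ a b → a ≤ n → b ≤ n → M a b ≡ M' a b) where
    private
      module Fm = Formula M
      module Fm' = Formula M'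

    cdIn-cong : ∀ k → k ≤ n → Fm.cdIn k ≡ Fm'.cdIn k
    cdIn-cong k k≤n = Σ<-cong N (λ u u<N → cong (when (not (inner u))) (M≗M' k u k≤n (s≤s⁻¹ u<N)))

    cdOut-cong : ∀ k → k ≤ n → Fm.cdOut k ≡ Fm'.cdOut k
    cdOut-cong k k≤n = Σ<-cong N (λ u u<N → cong (when (inner u)) (M≗M' k u k≤n (s≤s⁻¹ u<N)))

    cdIn'-cong : ∀ k → k ≤ n → Fm.cdIn' k ≡ Fm'.cdIn' k
    cdIn'-cong k k≤n = cdIn-cong (reflect k) (reflect≤n k k≤n)

    A-cong : ∀ k → Fm.A k ≡ Fm'.A k
    A-cong k = Σ<-cong N (λ s s<N → cong (when (inner s ∧ (s ≤ᵇ k))) (cdIn'-cong s (s≤s⁻¹ s<N)))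

    B-cong : ∀ k → Fm.B k ≡ Fm'.B k
    B-cong k = Σ<-cong N (λ s s<N → cong (when (not (inner s) ∧ (rank s ≤ᵇ rank k))) (cdOut-cong s (s≤s⁻¹ s<N)))

    cross-cong : ∀ a b → a ≤ n → b ≤ n → Fm.cross a b ≡ Fm'.cross a b
    cross-cong a b a≤n b≤n rewrite A-cong a | B-cong b | cdIn'-cong a a≤n | cdOut-cong b b≤n = refl

    newArc-cong : ∀ a b → a ≤ n → b ≤ n → Fm.newArc a b ≡ Fm'.newArc a b
    newArc-cong a b a≤n b≤n = Fm.newArc-by-cases a b
      (λ ea eb → trans (M≗M' _ _ (reflect≤n a a≤n) (reflect≤n b b≤n)) (sym (Fm'.newArc-inner-inner ea eb)))
      (λ ea eb → trans (cross-cong a b a≤n b≤n) (sym (Fm'.newArc-inner-outer ea eb)))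
      (λ ea eb → trans (cross-cong b a b≤n a≤n) (sym (Fm'.newArc-outer-inner ea eb)))
      (λ ea eb → trans (M≗M' a b a≤n b≤n) (sym (Fm'.newArc-outer-outer ea eb)))

  module Involution (M : ℕ → ℕ → ℕ) (symM : Symmetric n M) (mono : MonotoneAcross M) where
    open Formula M
    open Conservation M symM
    open Reconstruction M symM mono
    private
      module E = Formula newArc

    E-cdIn : ∀ k → inner k ≡ true → E.cdIn k ≡ cdIn' k
    E-cdIn k ek with inner-offset k ek
    ... | i<L , k≡ = trans (Σ<-cong N (λ u _ → when-outer-cong u (newArc-inner-outer ek)))
                           (subst (λ k → Σ< N (λ u → when (not (inner u)) (cross k u)) ≡ cdIn' k) k≡ (Σ-outer-cross (k ∸ p) i<L))

    E-inCount' : ∀ k → k < L → E.inCount' k ≡ inCount k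
    E-inCount' k k<L = trans (E-cdIn (reflect (p + k)) (trans (inner-reflect (p + k)) (inner-middle k k<L)))
                             (cong cdIn (reflect-involutive (p + k)))

    E-outCount : ∀ j → j < K → E.outCount j ≡ outCount j
    E-outCount j j<K = trans (Σ<-cong N (λ u _ → when-inner-cong u (λ eu → newArc-outer-inner (outer-not-inner j j<K) eu)))
                             (Σ-inner-cross j j<K)

    newArc-involutive : ∀ a b → a ≤ n → b ≤ n → E.newArc a b ≡ M a b
    newArc-involutive a b a≤n b≤n = E.newArc-by-cases a b
      (λ ea eb → trans (newArc-inner-inner (trans (inner-reflect a) ea) (trans (inner-reflect b) eb))
                       (cong₂ M (reflect-involutive a) (reflect-involutive b)))
      (λ ea eb → cross-reconstructs newArc E-inCount' E-outCount a b b≤n ea eb)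
      (λ ea eb → trans (cross-reconstructs newArc E-inCount' E-outCount b a a≤n eb ea) (symM b a b≤n a≤n))
      (λ ea eb → newArc-outer-outer ea eb)

  module Adjacent (q≡1+p : q ≡ suc p) (M : ℕ → ℕ → ℕ) (symM : Symmetric n M) (mono : MonotoneAcross M)
                  (loop : Loopless M) (degree≡ : Σ< N (M p) ≡ Σ< N (M q)) where
    open Formula M
    open Reconstruction M symM mono

    private
      p≤n : p ≤ n
      p≤n = ≤-trans p≤q q≤n

    L≡2 : L ≡ 2
    L≡2 = cong suc (trans (cong (_∸ p) (trans q≡1+p (+-comm 1 p))) (m+n∸m≡n p 1))

    p+1≡q : p + 1 ≡ q
    p+1≡q = trans (+-comm p 1) (sym q≡1+p)

    Σ-inner-adjacent : ∀ (f : ℕ → ℕ) → Σ< N (λ u → when (inner u) (f u)) ≡ f p + f q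
    Σ-inner-adjacent f = trans (Σ-inner f) (trans (cong (λ l → Σ< l (λ k → f (p + k))) L≡2)
      (cong₂ _+_ (cong f (+-identityʳ p)) (trans (+-identityʳ _) (cong f p+1≡q))))

    -- p and q have the same degree and the arcs between them contribute equally to both.
    cdIn-p≡cdIn-q : cdIn p ≡ cdIn q
    cdIn-p≡cdIn-q = +-cancelˡ-≡ (M p q) (cdIn p) (cdIn q) (begin
      M p q + cdIn p                                  ≡⟨ cong (λ x → x + M p q + cdIn p) (sym (loop p)) ⟩
      M p p + M p q + cdIn p                          ≡⟨ cong (_+ cdIn p) (sym (Σ-inner-adjacent (M p))) ⟩
      Σ< N (λ u → when (inner u) (M p u)) + cdIn p    ≡⟨ sym (Σ-inner+outer (M p)) ⟩
      Σ< N (M p)                                      ≡⟨ degree≡ ⟩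
      Σ< N (M q)                                      ≡⟨ Σ-inner+outer (M q) ⟩
      Σ< N (λ u → when (inner u) (M q u)) + cdIn q    ≡⟨ cong (_+ cdIn q) (Σ-inner-adjacent (M q)) ⟩
      M q p + M q q + cdIn q                          ≡⟨ cong (λ x → M q p + x + cdIn q) (loop q) ⟩
      M q p + 0 + cdIn q                              ≡⟨ cong (_+ cdIn q) (trans (+-identityʳ (M q p)) (symM q p q≤n p≤n)) ⟩
      M p q + cdIn q                                  ∎)
      where open ≡-Reasoning

    inCount'≗inCount : ∀ k → k < L → inCount' k ≡ inCount k
    inCount'≗inCount k k<L with k | subst (k <_) L≡2 k<L
    ... | 0 | _ = trans (cong cdIn (reflect-middle 0 (subst (0 <_) (sym L≡2) z<s)))
                        (trans (sym cdIn-p≡cdIn-q) (cong cdIn (sym (+-identityʳ p))))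
    ... | 1 | _ = trans (cong cdIn (trans (reflect-middle 1 (subst (1 <_) (sym L≡2) ≤-refl)) (cong (_∸ 1) q≡1+p)))
                        (trans cdIn-p≡cdIn-q (cong cdIn (sym p+1≡q)))
    ... | suc (suc _) | s≤s (s≤s ())

    reflect-swap : ∀ {a b} → inner a ≡ true → inner b ≡ true → M (reflect a) (reflect b) ≡ M a b
    reflect-swap ea eb with inner-adjacent q≡1+p ea | inner-adjacent q≡1+p eb
    ... | inj₁ refl | inj₁ refl = trans (cong₂ M reflect-p reflect-p) (trans (loop q) (sym (loop p)))
    ... | inj₁ refl | inj₂ refl = trans (cong₂ M reflect-p reflect-q) (symM q p q≤n p≤n)
    ... | inj₂ refl | inj₁ refl = trans (cong₂ M reflect-q reflect-p) (symM p q p≤n q≤n)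
    ... | inj₂ refl | inj₂ refl = trans (cong₂ M reflect-q reflect-q) (trans (loop p) (sym (loop q)))

    newArc-fixed : ∀ a b → a ≤ n → b ≤ n → newArc a b ≡ M a b
    newArc-fixed a b a≤n b≤n = newArc-by-cases a b
      reflect-swap
      (λ ea eb → cross-reconstructs M inCount'≗inCount (λ _ _ → refl) a b b≤n ea eb)
      (λ ea eb → trans (cross-reconstructs M inCount'≗inCount (λ _ _ → refl) b a a≤n eb ea) (symM b a b≤n a≤n))
      (λ _ _ → refl)

  noncrossing⇒monotone : ∀ {M} → Symmetric n M → NonCrossing n M → MonotoneAcross M
  noncrossing⇒monotone {M} symM nc a a' b b' p≤a a<a' a'≤q b≤n b'≤n eb eb' ab a'b'
    with inner-false⁻¹ eb | inner-false⁻¹ eb'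
  ... | inj₁ b<p | inj₁ b'<p = ≮⇒≥ λ r< →
    ¬crossing nc (rank-below-<⁻¹ b<p b'<p r<) (<-≤-trans b'<p p≤a) a<a' a'≤n
              (Arc-flip symM (≤-trans (<⇒≤ a<a') a'≤n) b≤n ab) (Arc-flip symM a'≤n b'≤n a'b')
    where
    a'≤n : a' ≤ n
    a'≤n = ≤-trans a'≤q q≤n
  ... | inj₁ b<p | inj₂ q<b' = rank-below≤above b<p (≤-trans p≤q (<⇒≤ q<b'))
  ... | inj₂ q<b | inj₁ b'<p = ⊥-elim
    (¬crossing nc (<-≤-trans b'<p p≤a) a<a' (≤-<-trans a'≤q q<b) b≤n (Arc-flip symM (≤-trans a'≤q q≤n) b'≤n a'b') ab)
  ... | inj₂ q<b | inj₂ q<b' = ≮⇒≥ λ r< →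
    ¬crossing nc a<a' (≤-<-trans a'≤q q<b) (rank-above-<⁻¹ (≤-trans p≤q (<⇒≤ q<b)) (≤-trans p≤q (<⇒≤ q<b')) r<) b'≤n ab a'b'

-- For α+1 < β, the diagram y = s_{α+1,β} x carries the point of x at β to α+1, next to α.
module FirstReflection (n α β : ℕ) (α+1<β : suc α < β) (β≤n : β ≤ n) (M : ℕ → ℕ → ℕ)
                       (symM : Symmetric n M) (nc : NonCrossing n M) (loop : Loopless M) where

  P : ℕ
  P = suc α

  P≤n : P ≤ n
  P≤n = ≤-trans (<⇒≤ α+1<β) β≤n

  α≤n : α ≤ n
  α≤n = ≤-trans (n≤1+n α) P≤n

  module G = Rejoin n P β α+1<β β≤n
  module H = Interval n α P (n<1+n α) P≤n
  open G using (N; L; K; inner; reflect; outer)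
  open G.Formula M
  open G.Conservation M symM

  y : ℕ → ℕ → ℕ
  y = newArc

  inner-α : inner α ≡ false
  inner-α = G.inner-false-below ≤-refl

  inner-P : inner P ≡ true
  inner-P = G.inner-true ≤-refl (<⇒≤ α+1<β)

  y-P-inner : ∀ {u} → inner u ≡ true → y P u ≡ M β (reflect u)
  y-P-inner {u} eu = trans (newArc-inner-inner {P} {u} inner-P eu) (cong (λ z → M z (reflect u)) G.reflect-p)

  y-symmetric : Symmetric n y
  y-symmetric = newArc-sym symM

  y-loopless : Loopless y
  y-loopless = newArc-loopless loop

  y-degree-α : Σ< N (y α) ≡ Σ< N (M α)
  y-degree-α = begin
    Σ< N (y α)
      ≡⟨ G.Σ-inner+outer (y α) ⟩
    Σ< N (λ u → when (inner u) (y α u)) + Σ< N (λ u → when (not (inner u)) (y α u))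
      ≡⟨ cong₂ _+_ (trans (Σ<-cong N (λ u _ → G.when-inner-cong u (newArc-outer-inner {α} {u} inner-α))) (Σ-inner-cross 0 z<s))
                   (Σ<-cong N (λ u _ → G.when-outer-cong u (newArc-outer-outer {α} {u} inner-α))) ⟩
    Σ< N (λ u → when (inner u) (M α u)) + Σ< N (λ u → when (not (inner u)) (M α u))
      ≡⟨ sym (G.Σ-inner+outer (M α)) ⟩
    Σ< N (M α)
      ∎
    where open ≡-Reasoning

  y-degree-P : Σ< N (y P) ≡ Σ< N (M β)
  y-degree-P = begin
    Σ< N (y P)
      ≡⟨ G.Σ-inner+outer (y P) ⟩
    Σ< N (λ u → when (inner u) (y P u)) + Σ< N (λ u → when (not (inner u)) (y P u))
      ≡⟨ cong₂ _+_ (Σ<-cong N (λ u _ → G.when-inner-cong u (y-P-inner {u})))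
                   (Σ<-cong N (λ u _ → G.when-outer-cong u (newArc-inner-outer {P} {u} inner-P))) ⟩
    Σ< N (λ u → when (inner u) (M β (reflect u))) + Σ< N (λ u → when (not (inner u)) (cross P u))
      ≡⟨ cong₂ _+_ (G.Σ-inner-reflect (M β))
                   (trans (subst (λ a → Σ< N (λ u → when (not (inner u)) (cross a u)) ≡ inCount' 0) (+-identityʳ P)
                                 (Σ-outer-cross 0 z<s))
                          (cong cdIn (G.reflect-middle 0 z<s))) ⟩
    Σ< N (λ u → when (inner u) (M β u)) + Σ< N (λ u → when (not (inner u)) (M β u))
      ≡⟨ sym (G.Σ-inner+outer (M β)) ⟩
    Σ< N (M β)
      ∎
    where open ≡-Reasoning

  data Side (b : ℕ) : Set where
    left   : b < α → Side b
    middle : P < b → b ≤ β → Side b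
    right  : β < b → Side b

  side : ∀ {b} → H.inner b ≡ false → Side b
  side {b} e with H.inner-false⁻¹ e
  ... | inj₁ b<α = left b<α
  ... | inj₂ P<b with b ≤? β
  ...   | yes b≤β = middle P<b b≤β
  ...   | no  b≰β = right (≰⇒> b≰β)

  α<right : ∀ {b} → β < b → α < b
  α<right β<b = <-trans (<-trans (n<1+n α) α+1<β) β<b

  partner : ∀ {b'} → inner b' ≡ false → 0 < y P b' → ∃ λ t → t ≤ n × (P ≤ t × t ≤ β) × Arc M b' t
  partner {b'} eb' pos with G.Σ-when-pos inner (M b')
                              (cross-pos⇒cdOut-pos {P} (subst (0 <_) (newArc-inner-outer {P} {b'} inner-P eb') pos))
  ... | t , t≤n , et , arc = t , t≤n , G.inner-true⁻¹ et , arc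

  ¬middle-outer : ∀ {b b'} → b' ≤ n → P < b → b ≤ β → inner b' ≡ false → b' ≢ α → 0 < y α b → 0 < y P b' → ⊥
  ¬middle-outer {b} {b'} b'≤n P<b b≤β eb' b'≢α pos pos'
    with G.inner-offset b (G.inner-true (<⇒≤ P<b) b≤β) | G.outer-surjective b' b'≤n eb'
  ... | i<L , b≡ | zero , _ , b'≡ = b'≢α (sym b'≡)
  ... | i<L , b≡ | suc j , j<K , b'≡ =
    NoCrossingRejoin.¬cross-out-of-order M (b ∸ P) (suc j) i<L j<K 1≤i (s≤s z≤n)
      (subst (0 <_) (trans (newArc-outer-inner {α} {b} inner-α eb) (cong (λ a → cross a α) (sym b≡))) pos)
      (subst (0 <_) (trans (newArc-inner-outer {P} {b'} inner-P eb') (cong₂ cross (sym (+-identityʳ P)) (sym b'≡))) pos')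
    where
    open G
    eb : inner b ≡ true
    eb = inner-true (<⇒≤ P<b) b≤β
    1≤i : 1 ≤ b ∸ P
    1≤i = ≤-trans (≤-reflexive (sym (m+n∸m≡n P 1))) (∸-monoˡ-≤ P (subst (_≤ b) (+-comm 1 P) P<b))

  -- y α b comes from an arc of x at reflect b leaving [P, β], y P b' is the arc of x from β
  -- to reflect b'; these two would cross unless b' ≤ b.
  middle-order : ∀ {b b'} → P < b → b ≤ β → P < b' → b' ≤ β → 0 < y α b → 0 < y P b' → H.rank b ≤ H.rank b'
  middle-order {b} {b'} P<b b≤β P<b' b'≤β pos pos' with b' ≤? b
  ... | yes b'≤b = H.rank-above-antitone (<⇒≤ (<-trans (n<1+n α) P<b')) b'≤b
  ... | no  b'≰b = ⊥-elim crossing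
    where
    eb : inner b ≡ true
    eb = G.inner-true (<⇒≤ P<b) b≤β
    eb' : inner b' ≡ true
    eb' = G.inner-true (<⇒≤ P<b') b'≤β
    not-true : ∀ {x} → not x ≡ true → x ≡ false
    not-true {false} _ = refl
    ρb'<ρb : reflect b' < reflect b
    ρb'<ρb = G.reflect-<-anti b b' eb eb' (≰⇒> b'≰b)
    ρb<β : reflect b < β
    ρb<β = subst (reflect b <_) G.reflect-p (G.reflect-<-anti P b inner-P eb P<b)
    P≤ρb' : P ≤ reflect b'
    P≤ρb' = proj₁ (G.reflect-bounds b' eb')
    ρb≤n : reflect b ≤ n
    ρb≤n = ≤-trans (proj₂ (G.reflect-bounds b eb)) β≤n
    arc' : Arc M (reflect b') β
    arc' = Arc-flip symM β≤n (≤-trans (proj₂ (G.reflect-bounds b' eb')) β≤n) (subst (0 <_) (y-P-inner {b'} eb') pos')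
    crossing : ⊥
    crossing with G.Σ-when-pos (λ v → not (inner v)) (M (reflect b))
                    (cross-pos⇒cdIn'-pos {b} {α} (subst (0 <_) (newArc-outer-inner {α} {b} inner-α eb) pos))
    ... | v , v≤n , ev , arc with G.inner-false⁻¹ (not-true ev)
    ...   | inj₁ v<P = ¬crossing nc (<-≤-trans v<P P≤ρb') ρb'<ρb ρb<β β≤n (Arc-flip symM ρb≤n v≤n arc) arc'
    ...   | inj₂ β<v = ¬crossing nc ρb'<ρb ρb<β β<v v≤n arc' arc

  arc-from-α : ∀ {b} → inner b ≡ false → 0 < y α b → Arc M α b
  arc-from-α {b} eb = subst (0 <_) (newArc-outer-outer {α} {b} inner-α eb)

  rank-order : ∀ {b b'} → b ≤ n → b' ≤ n → Side b → Side b' → 0 < y α b → 0 < y P b' → H.rank b ≤ H.rank b'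
  rank-order b≤n b'≤n (left b<α) (left b'<α) pos pos' with partner (G.inner-false-below (<-trans b'<α (n<1+n α))) pos'
  ... | t , t≤n , (P≤t , _) , arc = ≮⇒≥ λ r< →
    ¬crossing nc (H.rank-below-<⁻¹ b<α b'<α r<) b'<α P≤t t≤n
      (Arc-flip symM α≤n b≤n (arc-from-α (G.inner-false-below (<-trans b<α (n<1+n α))) pos)) arc
  rank-order _ _ (left b<α) (middle P<b' _) _ _ = H.rank-below≤above b<α (<⇒≤ (<-trans (n<1+n α) P<b'))
  rank-order _ _ (left b<α) (right β<b') _ _ = H.rank-below≤above b<α (<⇒≤ (α<right β<b'))
  rank-order _ b'≤n (middle P<b b≤β) (left b'<α) pos pos' =
    ⊥-elim (¬middle-outer b'≤n P<b b≤β (G.inner-false-below (<-trans b'<α (n<1+n α))) (<⇒≢ b'<α) pos pos')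
  rank-order _ _ (middle P<b b≤β) (middle P<b' b'≤β) pos pos' = middle-order P<b b≤β P<b' b'≤β pos pos'
  rank-order _ b'≤n (middle P<b b≤β) (right β<b') pos pos' =
    ⊥-elim (¬middle-outer b'≤n P<b b≤β (G.inner-false-above β<b') (≢-sym (<⇒≢ (α<right β<b'))) pos pos')
  rank-order b≤n b'≤n (right β<b) (left b'<α) pos pos' with partner (G.inner-false-below (<-trans b'<α (n<1+n α))) pos'
  ... | t , t≤n , (P≤t , t≤β) , arc =
    ⊥-elim (¬crossing nc b'<α P≤t (≤-<-trans t≤β β<b) b≤n arc (arc-from-α (G.inner-false-above β<b) pos))
  rank-order _ _ (right β<b) (middle P<b' b'≤β) _ _ =
    H.rank-above-antitone (<⇒≤ (<-trans (n<1+n α) P<b')) (<⇒≤ (≤-<-trans b'≤β β<b))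
  rank-order b≤n b'≤n (right β<b) (right β<b') pos pos' with partner (G.inner-false-above β<b') pos'
  ... | t , t≤n , (P≤t , t≤β) , arc = ≮⇒≥ λ r< →
    ¬crossing nc P≤t (≤-<-trans t≤β β<b) (H.rank-above-<⁻¹ (<⇒≤ (α<right β<b)) (<⇒≤ (α<right β<b')) r<) b'≤n
      (arc-from-α (G.inner-false-above β<b) pos) (Arc-flip symM b'≤n t≤n arc)

  y-monotone : H.MonotoneAcross y
  y-monotone a a' b b' α≤a a<a' a'≤P b≤n b'≤n eb eb' pos pos' =
    rank-order b≤n b'≤n (side eb) (side eb') (subst (λ z → 0 < y z b) a≡α pos) (subst (λ z → 0 < y z b') a'≡P pos')
    where
    a≡α : a ≡ α
    a≡α = ≤-antisym (s≤s⁻¹ (≤-trans a<a' a'≤P)) α≤a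
    a'≡P : a' ≡ P
    a'≡P = ≤-antisym a'≤P (≤-trans (s≤s α≤a) a<a')

-- Junk value: positions beyond n are sent to position 0.
fin : ∀ {n} → ℕ → Fin (suc n)
fin {n} k with k ≤? n
... | yes k≤n = fromℕ< (s≤s k≤n)
... | no  _   = F.zero

toℕ-fin : ∀ {n} k → k ≤ n → toℕ (fin {n} k) ≡ k
toℕ-fin {n} k k≤n with k ≤? n
... | yes k≤n' = toℕ-fromℕ< (s≤s k≤n')
... | no  k≰n  = ⊥-elim (k≰n k≤n)

fin-toℕ : ∀ {n} (t : Fin (suc n)) → fin (toℕ t) ≡ t
fin-toℕ t = toℕ-injective (toℕ-fin (toℕ t) (toℕ≤pred[n] t))

matrix : ∀ {n} → Diagram n → ℕ → ℕ → ℕ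
matrix x k l = arc x (fin k) (fin l)

matrix-toℕ : ∀ {n} (x : Diagram n) a b → matrix x (toℕ a) (toℕ b) ≡ arc x a b
matrix-toℕ x a b = cong₂ (arc x) (fin-toℕ a) (fin-toℕ b)

Σpos≡Σ< : ∀ {n} (f : Fin (suc n) → ℕ) (g : ℕ → ℕ) → (∀ t → f t ≡ g (toℕ t)) → Σpos f ≡ Σ< (suc n) g
Σpos≡Σ< {n} = sum-tabulate (suc n)

module ActionAsRejoin {n : ℕ} (x : Diagram n) (p q : ℕ) (1≤p : 1 ≤ p) (p<q : p < q) (q≤n : q ≤ n) where
  g : Gen n
  g = gen p q 1≤p p<q q≤n

  open Rejoin n p q p<q q≤n
  open Formula (matrix x)
  private
    module Act = Action g x

  refl-toℕ : ∀ t → toℕ (Act.refl t) ≡ reflect (toℕ t)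
  refl-toℕ t with p ≤? toℕ t | toℕ t ≤? q
  ... | yes p≤t | yes t≤q rewrite ≤ᵇ-true p≤t | ≤ᵇ-true t≤q = toℕ-fromℕ< _
  ... | yes p≤t | no  t≰q rewrite ≤ᵇ-true p≤t | ≤ᵇ-false (≰⇒> t≰q) = refl
  ... | no  p≰t | _       rewrite ≤ᵇ-false (≰⇒> p≰t) = refl

  cdIn-eq : ∀ t → Act.cdIn t ≡ cdIn (toℕ t)
  cdIn-eq t = Σpos≡Σ< _ (λ u → when (not (inner u)) (matrix x (toℕ t) u)) (λ u → cong (when (not (inner (toℕ u)))) (sym (matrix-toℕ x t u)))

  cdOut-eq : ∀ u → Act.cdOut u ≡ cdOut (toℕ u)
  cdOut-eq u = Σpos≡Σ< _ (λ t → when (inner t) (matrix x (toℕ u) t)) (λ t → cong (when (inner (toℕ t))) (sym (matrix-toℕ x u t)))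

  cdIn'-eq : ∀ t → Act.cdIn' t ≡ cdIn' (toℕ t)
  cdIn'-eq t = trans (cdIn-eq (Act.refl t)) (cong cdIn (refl-toℕ t))

  A-eq : ∀ a → Act.A a ≡ A (toℕ a)
  A-eq a = Σpos≡Σ< _ (λ s → when (inner s ∧ (s ≤ᵇ toℕ a)) (cdIn' s)) (λ s → cong (when (inner (toℕ s) ∧ (toℕ s ≤ᵇ toℕ a))) (cdIn'-eq s))

  B-eq : ∀ b → Act.B b ≡ B (toℕ b)
  B-eq b = Σpos≡Σ< _ (λ s → when (not (inner s) ∧ (rank s ≤ᵇ rank (toℕ b))) (cdOut s)) (λ s → cong (when (not (inner (toℕ s)) ∧ (rank (toℕ s) ≤ᵇ rank (toℕ b)))) (cdOut-eq s))

  cross-eq : ∀ a b → Act.cross a b ≡ cross (toℕ a) (toℕ b)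
  cross-eq a b rewrite A-eq a | B-eq b | cdIn'-eq a | cdOut-eq b = refl

  act-if : ∀ a b → arc (act g x) a b ≡ (if Act.inner a then (if Act.inner b then arc x (Act.refl a) (Act.refl b) else Act.cross a b)
                                                         else (if Act.inner b then Act.cross b a else arc x a b))
  act-if a b with Act.inner a | Act.inner b
  ... | true  | true  = refl
  ... | true  | false = refl
  ... | false | true  = refl
  ... | false | false = refl

  arc-act : ∀ a b → arc (act g x) a b ≡ newArc (toℕ a) (toℕ b)
  arc-act a b = trans (act-if a b)
    (cong₄ (λ u v w z → if Act.inner a then (if Act.inner b then u else v) else (if Act.inner b then w else z))
           (trans (sym (matrix-toℕ x _ _)) (cong₂ (matrix x) (refl-toℕ a) (refl-toℕ b)))
           (cross-eq a b) (cross-eq b a) (sym (matrix-toℕ x a b)))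

  matrix-act : ∀ k l → k ≤ n → l ≤ n → matrix (act g x) k l ≡ newArc k l
  matrix-act k l k≤n l≤n = trans (arc-act (fin k) (fin l)) (cong₂ newArc (toℕ-fin k k≤n) (toℕ-fin l l≤n))

-- On positions, s_{α+1,β} s_{α,α+1} s_{α+1,β} is the transposition of α and β.
module Conjugation (n α β : ℕ) (α+1<β : suc α < β) (β≤n : β ≤ n) where

  P : ℕ
  P = suc α

  P≤n : P ≤ n
  P≤n = ≤-trans (<⇒≤ α+1<β) β≤n

  module G = Interval n P β α+1<β β≤n
  module H = Interval n α P (n<1+n α) P≤n

  σ : ℕ → ℕ
  σ k = G.reflect (H.reflect (G.reflect k))

  σ-α : σ α ≡ β
  σ-α = trans (cong (λ z → G.reflect (H.reflect z)) (G.reflect-outer (G.inner-false-below ≤-refl)))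
              (trans (cong G.reflect H.reflect-p) G.reflect-p)

  σ-β : σ β ≡ α
  σ-β = trans (cong (λ z → G.reflect (H.reflect z)) G.reflect-q)
              (trans (cong G.reflect H.reflect-q) (G.reflect-outer (G.inner-false-below ≤-refl)))

  σ-fixes : ∀ k → k ≢ α → k ≢ β → σ k ≡ k
  σ-fixes k k≢α k≢β = by-side (G.inner k) refl
    where
    by-side : ∀ b → G.inner k ≡ b → σ k ≡ k
    by-side false e = trans (cong (λ z → G.reflect (H.reflect z)) (G.reflect-outer e))
                            (trans (cong G.reflect (H.reflect-outer H-outer)) (G.reflect-outer e))
      where
      H-outer : H.inner k ≡ false
      H-outer with G.inner-false⁻¹ e
      ... | inj₂ β<k = H.inner-false-above (<-trans α+1<β β<k)
      ... | inj₁ k<P with m≤n⇒m<n∨m≡n (s≤s⁻¹ k<P)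
      ...   | inj₁ k<α = H.inner-false-below k<α
      ...   | inj₂ k≡α = ⊥-elim (k≢α k≡α)
    by-side true e = trans (cong G.reflect (H.reflect-outer H-outer)) (G.reflect-involutive k)
      where
      ρk≢P : G.reflect k ≢ P
      ρk≢P eq = k≢β (trans (sym (G.reflect-involutive k)) (trans (cong G.reflect eq) G.reflect-p))
      H-outer : H.inner (G.reflect k) ≡ false
      H-outer with m≤n⇒m<n∨m≡n (proj₁ (G.reflect-bounds k e))
      ... | inj₁ P<ρk = H.inner-false-above P<ρk
      ... | inj₂ P≡ρk = ⊥-elim (ρk≢P (sym P≡ρk))

injective⇒surjective : ∀ {m} (f : Fin m → Fin m) → Injective _≡_ _≡_ f → ∀ y → ∃ λ t → f t ≡ y
injective⇒surjective {zero}  f _   ()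
injective⇒surjective {suc m} f inj y with any? (λ t → f t F.≟ y)
... | yes hit = hit
... | no  miss = ⊥-elim (<-irrefl refl (injective⇒≤ avoid-inj))
  where
  avoid : Fin (suc m) → Fin m
  avoid t = punchOut {i = y} {j = f t} (λ eq → miss (t , sym eq))
  avoid-inj : Injective _≡_ _≡_ avoid
  avoid-inj {a} {b} eq = inj (punchOut-injective (λ e → miss (a , sym e)) (λ e → miss (b , sym e)) eq)

transpose-matchˡ : ∀ {m} (a b : Fin m) → transpose a b a ≡ b
transpose-matchˡ a b with a F.≟ a
... | yes _ = refl
... | no a≢a = ⊥-elim (a≢a refl)

transpose-matchʳ : ∀ {m} (a b : Fin m) → transpose a b b ≡ a
transpose-matchʳ a b with b F.≟ a
... | yes b≡a = b≡a
... | no  _ with b F.≟ b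
...   | yes _ = refl
...   | no b≢b = ⊥-elim (b≢b refl)

transpose-fixes : ∀ {m} (a b k : Fin m) → k ≢ a → k ≢ b → transpose a b k ≡ k
transpose-fixes a b k k≢a k≢b with k F.≟ a
... | yes k≡a = ⊥-elim (k≢a k≡a)
... | no  _ with k F.≟ b
...   | yes k≡b = ⊥-elim (k≢b k≡b)
...   | no  _   = refl

transpose-comm : ∀ {m} (a b k : Fin m) → transpose b a k ≡ transpose a b k
transpose-comm a b k = by-cases (k F.≟ a) (k F.≟ b)
  where
  by-cases : Dec (k ≡ a) → Dec (k ≡ b) → transpose b a k ≡ transpose a b k
  by-cases (yes refl) _        = trans (transpose-matchʳ b k) (sym (transpose-matchˡ k b))
  by-cases (no  _)    (yes refl) = trans (transpose-matchˡ k a) (sym (transpose-matchʳ a k))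
  by-cases (no  k≢a)  (no  k≢b)  = trans (transpose-fixes b a k k≢b k≢a) (sym (transpose-fixes a b k k≢a k≢b))

module Swap {n : ℕ} {l : Fin n → ℕ} {l∞ : ℕ} (x : X l l∞) (i j : Fin n) (li≡lj : l i ≡ l j)
            (ta tb : Fin (suc n)) (la : lab (diagram x) ta ≡ F.suc i) (lb : lab (diagram x) tb ≡ F.suc j)
            (ta<tb : toℕ ta < toℕ tb) where

  d : Diagram n
  d = diagram x
  open IsArcDiagram (valid x)

  α β : ℕ
  α = toℕ ta
  β = toℕ tb

  M : ℕ → ℕ → ℕ
  M = matrix d

  M-symmetric : Symmetric n M
  M-symmetric a b _ _ = arc-sym (fin a) (fin b)

  M-loopless : Loopless M
  M-loopless a = arc-loop (fin a)

  M-noncrossing : NonCrossing n M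
  M-noncrossing a b c e a<b b<c c<e e≤n = arc-noncrossing (fin a) (fin b) (fin c) (fin e)
      (subst₂ _<_ (sym (toℕ-fin a a≤n)) (sym (toℕ-fin b b≤n)) a<b)
      (subst₂ _<_ (sym (toℕ-fin b b≤n)) (sym (toℕ-fin c c≤n)) b<c)
      (subst₂ _<_ (sym (toℕ-fin c c≤n)) (sym (toℕ-fin e e≤n)) c<e)
    where
    c≤n : c ≤ n
    c≤n = ≤-trans (<⇒≤ c<e) e≤n
    b≤n : b ≤ n
    b≤n = ≤-trans (<⇒≤ b<c) c≤n
    a≤n : a ≤ n
    a≤n = ≤-trans (<⇒≤ a<b) b≤n

  M-degree : ∀ t → Σ< (suc n) (M (toℕ t)) ≡ lvec l l∞ (lab d t)
  M-degree t = trans (sym (Σpos≡Σ< (arc d t) (M (toℕ t)) (λ u → sym (matrix-toℕ d t u)))) (degree t)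

  equal-degrees : Σ< (suc n) (M α) ≡ Σ< (suc n) (M β)
  equal-degrees = begin
    Σ< (suc n) (M α)        ≡⟨ M-degree ta ⟩
    lvec l l∞ (lab d ta)    ≡⟨ cong (lvec l l∞) la ⟩
    l i                     ≡⟨ li≡lj ⟩
    l j                     ≡⟨ cong (lvec l l∞) (sym lb) ⟩
    lvec l l∞ (lab d tb)    ≡⟨ sym (M-degree tb) ⟩
    Σ< (suc n) (M β)        ∎
    where open ≡-Reasoning

  1≤α : 1 ≤ α
  1≤α = labelled-positive ta la
    where
    labelled-positive : ∀ t → lab d t ≡ F.suc i → 1 ≤ toℕ t
    labelled-positive F.zero    e = contradiction (trans (sym lab-∞) e) λ ()
    labelled-positive (F.suc _) _ = s≤s z≤n

  β≤n : β ≤ n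
  β≤n = toℕ≤pred[n] tb

  relabel : (τ : Fin (suc n) → Fin (suc n)) (σ : ℕ → ℕ) → (∀ t → toℕ (τ t) ≡ σ (toℕ t)) →
            σ α ≡ β → σ β ≡ α → (∀ k → k ≢ α → k ≢ β → σ k ≡ k) →
            ∀ t → lab d (τ t) ≡ transpose (F.suc i) (F.suc j) (lab d t)
  relabel τ σ τ≡σ σα σβ σ-fixes t with t F.≟ ta | t F.≟ tb
  ... | yes refl | _ = begin
    lab d (τ ta)                                ≡⟨ cong (lab d) (toℕ-injective (trans (τ≡σ ta) σα)) ⟩
    lab d tb                                    ≡⟨ lb ⟩
    F.suc j                                     ≡⟨ sym (transpose-matchˡ (F.suc i) (F.suc j)) ⟩
    transpose (F.suc i) (F.suc j) (F.suc i)     ≡⟨ cong (transpose (F.suc i) (F.suc j)) (sym la) ⟩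
    transpose (F.suc i) (F.suc j) (lab d ta)    ∎
    where open ≡-Reasoning
  ... | no _ | yes refl = begin
    lab d (τ tb)                                ≡⟨ cong (lab d) (toℕ-injective (trans (τ≡σ tb) σβ)) ⟩
    lab d ta                                    ≡⟨ la ⟩
    F.suc i                                     ≡⟨ sym (transpose-matchʳ (F.suc i) (F.suc j)) ⟩
    transpose (F.suc i) (F.suc j) (F.suc j)     ≡⟨ cong (transpose (F.suc i) (F.suc j)) (sym lb) ⟩
    transpose (F.suc i) (F.suc j) (lab d tb)    ∎
    where open ≡-Reasoning
  ... | no t≢ta | no t≢tb = trans
    (cong (lab d) (toℕ-injective (trans (τ≡σ t) (σ-fixes (toℕ t) (t≢ta ∘ toℕ-injective) (t≢tb ∘ toℕ-injective)))))
    (sym (transpose-fixes _ _ _ (λ e → t≢ta (lab-inj (trans e (sym la)))) (λ e → t≢tb (lab-inj (trans e (sym lb))))))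

  adjacent-swap : β ≡ suc α → ∃ λ w → actWord w d ≈D swapLabels i j d
  adjacent-swap β≡1+α = h ∷ [] , record { lab-≈ = labels ; arc-≈ = arcs }
    where
    open Rejoin n α β ta<tb β≤n
    module Hd = ActionAsRejoin d α β 1≤α ta<tb β≤n
    h : Gen n
    h = Hd.g
    labels : ∀ t → lab d (Action.refl h d t) ≡ transpose (F.suc i) (F.suc j) (lab d t)
    labels = relabel (Action.refl h d) reflect Hd.refl-toℕ reflect-p reflect-q (reflect-adjacent-fixes β≡1+α)
    arcs : ∀ a b → arc (act h d) a b ≡ arc d a b
    arcs a b = begin
      arc (act h d) a b                       ≡⟨ Hd.arc-act a b ⟩
      Formula.newArc M (toℕ a) (toℕ b)
        ≡⟨ Adjacent.newArc-fixed β≡1+α M M-symmetric (noncrossing⇒monotone M-symmetric M-noncrossing) M-loopless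
             equal-degrees (toℕ a) (toℕ b) (toℕ≤pred[n] a) (toℕ≤pred[n] b) ⟩
      M (toℕ a) (toℕ b)                       ≡⟨ matrix-toℕ d a b ⟩
      arc d a b                               ∎
      where open ≡-Reasoning

  conjugate-swap : suc α < β → ∃ λ w → actWord w d ≈D swapLabels i j d
  conjugate-swap α+1<β = g ∷ h ∷ g ∷ [] , record { lab-≈ = labels ; arc-≈ = arcs }
    where
    open Conjugation n α β α+1<β β≤n using (P; P≤n; σ; σ-α; σ-β; σ-fixes)
    module GR = Rejoin n P β α+1<β β≤n
    module HR = Rejoin n α P (n<1+n α) P≤n
    module Y = FirstReflection n α β α+1<β β≤n M M-symmetric M-noncrossing M-loopless
    module Gd = ActionAsRejoin d P β (s≤s z≤n) α+1<β β≤n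
    g h : Gen n
    g = Gd.g
    h = gen α P 1≤α (n<1+n α) P≤n
    y z : Diagram n
    y = act g d
    z = act h y
    module Hy = ActionAsRejoin y α P 1≤α (n<1+n α) P≤n
    module Gz = ActionAsRejoin z P β (s≤s z≤n) α+1<β β≤n

    y-equal-degrees : Σ< (suc n) (Y.y α) ≡ Σ< (suc n) (Y.y P)
    y-equal-degrees = trans Y.y-degree-α (trans equal-degrees (sym Y.y-degree-P))

    matrix-z : ∀ k l → k ≤ n → l ≤ n → matrix z k l ≡ Y.y k l
    matrix-z k l k≤n l≤n = begin
      matrix z k l                           ≡⟨ Hy.matrix-act k l k≤n l≤n ⟩
      HR.Formula.newArc (matrix y) k l       ≡⟨ HR.Congruence.newArc-cong (matrix y) Y.y Gd.matrix-act k l k≤n l≤n ⟩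
      HR.Formula.newArc Y.y k l              ≡⟨ HR.Adjacent.newArc-fixed refl Y.y Y.y-symmetric Y.y-monotone Y.y-loopless
                                                  y-equal-degrees k l k≤n l≤n ⟩
      Y.y k l                                ∎
      where open ≡-Reasoning

    arcs : ∀ a b → arc (act g z) a b ≡ arc d a b
    arcs a b = begin
      arc (act g z) a b                      ≡⟨ Gz.arc-act a b ⟩
      GR.Formula.newArc (matrix z) a' b'     ≡⟨ GR.Congruence.newArc-cong (matrix z) Y.y matrix-z a' b' a≤n b≤n ⟩
      GR.Formula.newArc Y.y a' b'            ≡⟨ GR.Involution.newArc-involutive M M-symmetric
                                                  (GR.noncrossing⇒monotone M-symmetric M-noncrossing) a' b' a≤n b≤n ⟩
      M a' b'                                ≡⟨ matrix-toℕ d a b ⟩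
      arc d a b                              ∎
      where
      open ≡-Reasoning
      a' b' : ℕ
      a' = toℕ a
      b' = toℕ b
      a≤n : a' ≤ n
      a≤n = toℕ≤pred[n] a
      b≤n : b' ≤ n
      b≤n = toℕ≤pred[n] b

    τ : Fin (suc n) → Fin (suc n)
    τ t = Action.refl g d (Action.refl h y (Action.refl g z t))

    τ≡σ : ∀ t → toℕ (τ t) ≡ σ (toℕ t)
    τ≡σ t = trans (Gd.refl-toℕ (Action.refl h y (Action.refl g z t)))
                  (cong GR.reflect (trans (Hy.refl-toℕ (Action.refl g z t)) (cong HR.reflect (Gz.refl-toℕ t))))

    labels : ∀ t → lab d (τ t) ≡ transpose (F.suc i) (F.suc j) (lab d t)
    labels = relabel τ σ τ≡σ σ-α σ-β σ-fixes

  swap : ∃ λ w → actWord w d ≈D swapLabels i j d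
  swap with m≤n⇒m<n∨m≡n ta<tb
  ... | inj₁ α+1<β = conjugate-swap α+1<β
  ... | inj₂ α+1≡β = adjacent-swap (sym α+1≡β)

lemma3p2 : (n : ℕ) → 2 ≤ n → (l : Fin n → ℕ) (l∞ : ℕ) (x : X l l∞)
           (i j : Fin n) → i ≢ j → l i ≡ l j →
           ∃ λ (w : List (Gen n)) →
             actWord w (diagram x) ≈D swapLabels i j (diagram x)
lemma3p2 n _ l l∞ x i j i≢j li≡lj
  with injective⇒surjective (lab (diagram x)) (IsArcDiagram.lab-inj (valid x)) (F.suc i)
     | injective⇒surjective (lab (diagram x)) (IsArcDiagram.lab-inj (valid x)) (F.suc j)
... | ta , la | tb , lb with <-cmp (toℕ ta) (toℕ tb)
...   | tri< ta<tb _ _ = Swap.swap x i j li≡lj ta tb la lb ta<tb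
...   | tri≈ _ ta≡tb _ = ⊥-elim (i≢j (Fin-suc-injective (trans (sym la) (trans (cong (lab (diagram x)) (toℕ-injective ta≡tb)) lb))))
...   | tri> _ _ tb<ta with Swap.swap x j i (sym li≡lj) tb ta lb la tb<ta
...     | w , swapped = w , record
  { lab-≈ = λ t → trans (_≈D_.lab-≈ swapped t) (transpose-comm (F.suc i) (F.suc j) (lab (diagram x) t))
  ; arc-≈ = _≈D_.arc-≈ swapped }
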